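{- Let $\Lambda(z)=\lambda_2z^2+\lambda_3z^3+\cdots$ be a formal power series with coefficients in a field of characteristic $0$, where $\lambda_2\ne0$. Then the equation \[H=t+k\Lambda(H)\] has a unique formal power series solution $H(t,k)=t+\lambda_2kt^2+(\lambda_3k+2\lambda_2^2k^2)t^3+\cdots$, in which the coefficient of $t^n$ is a polynomial in $k$ of degree $n-1$. Let $\mu_l(n)/n!$ be the coefficient of $k^{n-l}t^n$ in $H(t,k)$. Then for each $l$, $\sum_{n=0}^\infty\mu_l(n)t^n/n!$ is a Laurent polynomial in $\sqrt{1-4\lambda_2t}$ with no even negative powers. -}

module Defs where

open import Level using (_⊔_)
open import Data.Nat using (ℕ; zero; suc; _∸_; _≤_; _≤?_) renaming (_+_ to _+ℕ_)
open import Data.List using (List; []; _∷_)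
open import Data.Product using (∃)
open import Relation.Nullary using (¬_; yes; no)
open import Relation.Binary.PropositionalEquality using (_≡_)
open import Algebra.Bundles using (CommutativeRing)
import Algebra.Definitions.RawMonoid as RM

module PowerSeries {c ℓ} (R : CommutativeRing c ℓ) where
  open CommutativeRing R

  open RM +-rawMonoid using () renaming (_×_ to _·ℕ_) public

  IsField : Set (c ⊔ ℓ)
  IsField = (¬ (1# ≈ 0#)) Data.Product.× (∀ x → ¬ (x ≈ 0#) → ∃ λ y → x * y ≈ 1#)

  CharZero : Set ℓ
  CharZero = ∀ n → n ·ℕ 1# ≈ 0# → n ≡ 0

  sumTo : ℕ → (ℕ → Carrier) → Carrier
  sumTo zero    f = f 0
  sumTo (suc n) f = sumTo n f + f (suc n)

  Series : Set c
  Series = ℕ → Carrier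

  _≈ₛ_ : Series → Series → Set ℓ
  A ≈ₛ B = ∀ n → A n ≈ B n

  zeroₛ : Series
  zeroₛ _ = 0#

  oneₛ : Series
  oneₛ zero    = 1#
  oneₛ (suc _) = 0#

  tₛ : Series
  tₛ 1 = 1#
  tₛ _ = 0#

  _+ₛ_ : Series → Series → Series
  (A +ₛ B) n = A n + B n

  _-ₛ_ : Series → Series → Series
  (A -ₛ B) n = A n - B n

  _·ₛ_ : Carrier → Series → Series
  (a ·ₛ B) n = a * B n

  _*ₛ_ : Series → Series → Series
  (A *ₛ B) n = sumTo n (λ i → A i * B (n ∸ i))

  polyₛ : List Carrier → Series → Series
  polyₛ []       X = zeroₛ
  polyₛ (a ∷ as) X = (a ·ₛ oneₛ) +ₛ (X *ₛ polyₛ as X)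

  -- bivariate series in t and k :  H n m = coefficient of t^n k^m
  Series₂ : Set c
  Series₂ = ℕ → ℕ → Carrier

  _≈₂_ : Series₂ → Series₂ → Set ℓ
  A ≈₂ B = ∀ n m → A n m ≈ B n m

  one₂ : Series₂
  one₂ zero zero = 1#
  one₂ _    _    = 0#

  _*₂_ : Series₂ → Series₂ → Series₂
  (A *₂ B) n m = sumTo n (λ i → sumTo m (λ j → A i j * B (n ∸ i) (m ∸ j)))

  pow₂ : Series₂ → ℕ → Series₂
  pow₂ H zero    = one₂
  pow₂ H (suc j) = H *₂ pow₂ H j

  -- Composition Λ(H) of a univariate series Λ(z) = Σ λⱼ zʲ with a
  -- bivariate series H having zero constant term (H 0 0 ≈ 0).  Under that
  -- hypothesis Hʲ has no terms of total degree < j, so the coefficient of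
  -- t^n k^m in Λ(H) is the finite sum below.
  compose : Series → Series₂ → Series₂
  compose Λ H n m = sumTo (n +ℕ m) (λ j → Λ j * pow₂ H j n m)

  rhs : Series → Series₂ → Series₂
  rhs Λ H zero          zero    = 0#
  rhs Λ H (suc zero)    zero    = 1#
  rhs Λ H (suc (suc _)) zero    = 0#
  rhs Λ H n             (suc m) = compose Λ H n m

  IsSolution : Series → Series₂ → Set ℓ
  IsSolution Λ H = (H 0 0 ≈ 0#) Data.Product.× (H ≈₂ rhs Λ H)

  -- Σ_n [k^(n-l) t^n] H · t^n   (coefficient 0 when n < l);
  -- this is Σ_n μ_l(n) tⁿ / n! in the paper's notation
  diagonal : Series₂ → ℕ → Series
  diagonal H l n with l ≤? n
  ... | yes _ = H n (n ∸ l)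
  ... | no  _ = 0#

  LaurentNoEvenNeg : Series → Series → Series → Set (c ⊔ ℓ)
  LaurentNoEvenNeg S Sinv F =
    ∃ λ (pos : List Carrier) → ∃ λ (neg : List Carrier) →
      F ≈ₛ (polyₛ pos S +ₛ (Sinv *ₛ polyₛ neg (Sinv *ₛ Sinv)))

-- Write H = Σ H n m tⁿ kᵐ. Column by column the equation forces H n m = 0 for
-- n ≤ m, so H is encoded by its diagonals W_q(t) = Σₙ H n (n−1−q) tⁿ, and since
-- diagonals multiply like Laurent series in k⁻¹, W = Σ_q W_q uᑫ satisfies
-- W = t + Σ_{j≥2} λⱼ u^(j−2) Wʲ.  Its u⁰-part is W₀ = t + λ₂W₀², so the
-- coefficient of t^(n+1) in W₀ (that of t^(n+1)kⁿ in H) is λ₂ⁿ times a Catalan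
-- number, hence nonzero, and W₀ = (1 − S)/(2λ₂).
--
-- The same equation has a second solution W̃ with W̃₀ = (1 + S)/(2λ₂), since for
-- q ≥ 1 its uᑫ-part is linear in W̃_q with the unit coefficient −S.  Cancelling
-- D = W − W̃ (whose u⁰-part −S/λ₂ is a unit) from the difference of the two
-- equations, and adding them, gives equations determining the uᑫ-parts of
-- σ₁ = W + W̃ and σ₂ = W W̃ from the lower ones, because (Wʲ − W̃ʲ)/D and
-- Wʲ + W̃ʲ are polynomials in σ₁ and σ₂.  By induction these parts are
-- polynomials in S² = 1 − 4λ₂t.  Then D² = σ₁² − 4σ₂ makes every D_q odd in S
-- (S⁻¹ times a Laurent polynomial in S²), so W_q = (σ₁ + D)_q / 2 has no even
-- negative powers of S.

module Submission where

open import Level using (_⊔_)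
open import Function using (_∘_)
open import Data.Empty using (⊥-elim)
open import Data.Nat using (ℕ; zero; suc; _≤_; _<_; _∸_; z≤n; s≤s; _≟_; _≤?_; _<?_)
  renaming (_+_ to _+ℕ_; _*_ to _*ℕ_)
import Data.Nat.Properties as ℕP
open import Data.Nat.Induction using (<-rec)
open import Data.Nat.Tactic.RingSolver using (solve-∀)
open import Data.Product using (Σ; _×_; _,_; proj₁; proj₂)
open import Data.Sum using (_⊎_; inj₁; inj₂)
open import Data.List using (List; []; _∷_; map)
open import Data.Maybe using (Maybe; just; nothing)
open import Relation.Nullary using (¬_; Dec; yes; no)
open import Relation.Binary.PropositionalEquality as ≡ using (_≡_)
open import Relation.Binary.Bundles using (Setoid)
open import Algebra.Bundles using (CommutativeRing; RawRing)
open import Defs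

module FiniteSums {c ℓ} (R : CommutativeRing c ℓ) where
  open CommutativeRing R
  open PowerSeries R using (sumTo)
  open import Algebra.Properties.CommutativeSemigroup +-commutativeSemigroup using (interchange)
  open import Algebra.Properties.AbelianGroup +-abelianGroup using (⁻¹-∙-comm)
  open import Relation.Binary.Reasoning.Setoid setoid

  sumTo-cong≤ : ∀ n {f g : ℕ → Carrier} → (∀ i → i ≤ n → f i ≈ g i) → sumTo n f ≈ sumTo n g
  sumTo-cong≤ zero    f≈g = f≈g 0 z≤n
  sumTo-cong≤ (suc n) f≈g =
    +-cong (sumTo-cong≤ n (λ i i≤n → f≈g i (ℕP.m≤n⇒m≤1+n i≤n))) (f≈g (suc n) ℕP.≤-refl)

  sumTo-cong : ∀ n {f g : ℕ → Carrier} → (∀ i → f i ≈ g i) → sumTo n f ≈ sumTo n g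
  sumTo-cong n f≈g = sumTo-cong≤ n (λ i _ → f≈g i)

  sumTo-zero : ∀ n {f : ℕ → Carrier} → (∀ i → i ≤ n → f i ≈ 0#) → sumTo n f ≈ 0#
  sumTo-zero n {f} f≈0 = begin
    sumTo n f           ≈⟨ sumTo-cong≤ n f≈0 ⟩
    sumTo n (λ _ → 0#)  ≈⟨ zeros n ⟩
    0#                  ∎
    where
    zeros : ∀ n → sumTo n (λ _ → 0#) ≈ 0#
    zeros zero    = refl
    zeros (suc n) = trans (+-identityʳ _) (zeros n)

  sumTo-+ : ∀ n (f g : ℕ → Carrier) → sumTo n (λ i → f i + g i) ≈ sumTo n f + sumTo n g
  sumTo-+ zero    f g = refl
  sumTo-+ (suc n) f g = trans (+-congʳ (sumTo-+ n f g)) (interchange _ _ _ _)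

  sumTo-*ˡ : ∀ n a (f : ℕ → Carrier) → sumTo n (λ i → a * f i) ≈ a * sumTo n f
  sumTo-*ˡ zero    a f = refl
  sumTo-*ˡ (suc n) a f = trans (+-congʳ (sumTo-*ˡ n a f)) (sym (distribˡ _ _ _))

  sumTo-neg : ∀ n (f : ℕ → Carrier) → sumTo n (λ i → - f i) ≈ - sumTo n f
  sumTo-neg zero    f = refl
  sumTo-neg (suc n) f = trans (+-congʳ (sumTo-neg n f)) (⁻¹-∙-comm _ _)

  sumTo-sucˡ : ∀ n (f : ℕ → Carrier) → sumTo (suc n) f ≈ f 0 + sumTo n (f ∘ suc)
  sumTo-sucˡ zero    f = refl
  sumTo-sucˡ (suc n) f = trans (+-congʳ (sumTo-sucˡ n f)) (+-assoc _ _ _)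

  sumTo-reverse : ∀ n (f : ℕ → Carrier) → sumTo n f ≈ sumTo n (λ i → f (n ∸ i))
  sumTo-reverse zero    f = refl
  sumTo-reverse (suc n) f = begin
    sumTo n f + f (suc n)                  ≈⟨ +-congʳ (sumTo-reverse n f) ⟩
    sumTo n (λ i → f (n ∸ i)) + f (suc n)  ≈⟨ +-comm _ _ ⟩
    f (suc n) + sumTo n (λ i → f (n ∸ i))  ≈⟨ sumTo-sucˡ n (λ i → f (suc n ∸ i)) ⟨
    sumTo (suc n) (λ i → f (suc n ∸ i))    ∎

  sumTo-swap : ∀ n m (g : ℕ → ℕ → Carrier) →
    sumTo n (λ i → sumTo m (g i)) ≈ sumTo m (λ j → sumTo n (λ i → g i j))
  sumTo-swap zero    m g = refl
  sumTo-swap (suc n) m g =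
    trans (+-congʳ (sumTo-swap n m g)) (sym (sumTo-+ m _ (g (suc n))))

  sumTo-antidiagonal : ∀ n (g : ℕ → ℕ → Carrier) →
    sumTo n (λ k → sumTo k (λ i → g i (k ∸ i))) ≈ sumTo n (λ i → sumTo (n ∸ i) (g i))
  sumTo-antidiagonal zero    g = refl
  sumTo-antidiagonal (suc n) g = begin
    sumTo (suc n) (λ k → sumTo k (λ i → g i (k ∸ i)))
      ≈⟨ sumTo-sucˡ n _ ⟩
    g 0 0 + sumTo n (λ k → sumTo (suc k) (λ i → g i (suc k ∸ i)))
      ≈⟨ +-congˡ (sumTo-cong n (λ k → sumTo-sucˡ k (λ i → g i (suc k ∸ i)))) ⟩
    g 0 0 + sumTo n (λ k → g 0 (suc k) + sumTo k (λ i → g (suc i) (k ∸ i)))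
      ≈⟨ +-congˡ (sumTo-+ n _ _) ⟩
    g 0 0 + (sumTo n (g 0 ∘ suc) + sumTo n (λ k → sumTo k (λ i → g (suc i) (k ∸ i))))
      ≈⟨ +-assoc _ _ _ ⟨
    (g 0 0 + sumTo n (g 0 ∘ suc)) + sumTo n (λ k → sumTo k (λ i → g (suc i) (k ∸ i)))
      ≈⟨ +-cong (sym (sumTo-sucˡ n (g 0))) (sumTo-antidiagonal n (g ∘ suc)) ⟩
    sumTo (suc n) (g 0) + sumTo n (λ i → sumTo (n ∸ i) (g (suc i)))
      ≈⟨ sumTo-sucˡ n _ ⟨
    sumTo (suc n) (λ i → sumTo (suc n ∸ i) (g i)) ∎

  sumTo-triangle-swap : ∀ n (g : ℕ → ℕ → Carrier) →
    sumTo n (λ i → sumTo (n ∸ i) (g i)) ≈ sumTo n (λ j → sumTo (n ∸ j) (λ i → g i j))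
  sumTo-triangle-swap n g = begin
    sumTo n (λ i → sumTo (n ∸ i) (g i))                   ≈⟨ sumTo-antidiagonal n g ⟨
    sumTo n (λ k → sumTo k (λ i → g i (k ∸ i)))           ≈⟨ sumTo-cong n (λ k → sumTo-reverse k _) ⟩
    sumTo n (λ k → sumTo k (λ j → g (k ∸ j) (k ∸ (k ∸ j))))
      ≈⟨ sumTo-cong n (λ k → sumTo-cong≤ k (λ j j≤k → reflexive (≡.cong (g (k ∸ j)) (ℕP.m∸[m∸n]≡n j≤k)))) ⟩
    sumTo n (λ k → sumTo k (λ j → g (k ∸ j) j))           ≈⟨ sumTo-antidiagonal n (λ j i → g i j) ⟩
    sumTo n (λ j → sumTo (n ∸ j) (λ i → g i j))           ∎

  sumTo-extend : ∀ m n {f : ℕ → Carrier} → m ≤ n → (∀ i → m < i → i ≤ n → f i ≈ 0#) →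
    sumTo n f ≈ sumTo m f
  sumTo-extend m zero    z≤n f≈0 = refl
  sumTo-extend m (suc n) m≤1+n f≈0 with ℕP.m≤n⇒m<n∨m≡n m≤1+n
  ... | inj₂ ≡.refl = refl
  ... | inj₁ (s≤s m≤n) =
    trans (+-cong (sumTo-extend m n m≤n (λ i m<i i≤n → f≈0 i m<i (ℕP.m≤n⇒m≤1+n i≤n)))
                  (f≈0 (suc n) (s≤s m≤n) ℕP.≤-refl))
          (+-identityʳ _)

module SumReflection {c ℓ} (R : CommutativeRing c ℓ) where
  open CommutativeRing R
  open PowerSeries R using (sumTo)
  open FiniteSums R

  restrict : ℕ → (ℕ → Carrier) → ℕ → Carrier
  restrict M f j with j ≤? M
  ... | yes _ = f j
  ... | no  _ = 0#

  restrict-≤ : ∀ M f j → j ≤ M → restrict M f j ≈ f j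
  restrict-≤ M f j j≤M with j ≤? M
  ... | yes _   = refl
  ... | no  j≰M = ⊥-elim (j≰M j≤M)

  restrict-≰ : ∀ M f j → ¬ (j ≤ M) → restrict M f j ≈ 0#
  restrict-≰ M f j j≰M with j ≤? M
  ... | yes j≤M = ⊥-elim (j≰M j≤M)
  ... | no  _   = refl

  sumTo-restrict : ∀ M u f → (∀ j → j ≤ M → u < j → f j ≈ 0#) → sumTo M f ≈ sumTo u (restrict M f)
  sumTo-restrict M u f f≈0 = trans (sumTo-cong≤ M (λ j j≤M → sym (restrict-≤ M f j j≤M))) (resize (ℕP.≤-total M u))
    where
    resize : (M ≤ u) ⊎ (u ≤ M) → sumTo M (restrict M f) ≈ sumTo u (restrict M f)
    resize (inj₁ M≤u) = sym (sumTo-extend M u M≤u (λ j M<j _ → restrict-≰ M f j (ℕP.<⇒≱ M<j)))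
    resize (inj₂ u≤M) = sumTo-extend u M u≤M (λ j u<j j≤M → trans (restrict-≤ M f j j≤M) (f≈0 j j≤M u<j))

  -- Reindexing by j ↦ u ∸ j: every term left unmatched must vanish.
  sumTo-reflect : ∀ M N u {f g : ℕ → Carrier} →
    (∀ j → j ≤ M → u < j → f j ≈ 0#) →
    (∀ j → j ≤ M → j ≤ u → N < u ∸ j → f j ≈ 0#) →
    (∀ r → r ≤ N → u < r → g r ≈ 0#) →
    (∀ r → r ≤ N → r ≤ u → M < u ∸ r → g r ≈ 0#) →
    (∀ j → j ≤ M → j ≤ u → u ∸ j ≤ N → f j ≈ g (u ∸ j)) →
    sumTo M f ≈ sumTo N g
  sumTo-reflect M N u {f} {g} f-beyond-u f-unmatched g-beyond-u g-unmatched f≈g =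
    trans (sumTo-restrict M u f f-beyond-u)
      (trans (sumTo-cong≤ u (λ j j≤u → matched j j≤u (j ≤? M) ((u ∸ j) ≤? N)))
        (trans (sym (sumTo-reverse u (restrict N g))) (sym (sumTo-restrict N u g g-beyond-u))))
    where
    matched : ∀ j → j ≤ u → Dec (j ≤ M) → Dec (u ∸ j ≤ N) → restrict M f j ≈ restrict N g (u ∸ j)
    matched j j≤u (yes j≤M) (yes k≤N) =
      trans (restrict-≤ M f j j≤M) (trans (f≈g j j≤M j≤u k≤N) (sym (restrict-≤ N g (u ∸ j) k≤N)))
    matched j j≤u (yes j≤M) (no k≰N) =
      trans (restrict-≤ M f j j≤M) (trans (f-unmatched j j≤M j≤u (ℕP.≰⇒> k≰N)) (sym (restrict-≰ N g (u ∸ j) k≰N)))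
    matched j j≤u (no j≰M) (yes k≤N) =
      trans (restrict-≰ M f j j≰M) (sym (trans (restrict-≤ N g (u ∸ j) k≤N)
        (g-unmatched (u ∸ j) k≤N (ℕP.m∸n≤m u j) (≡.subst (M <_) (≡.sym (ℕP.m∸[m∸n]≡n j≤u)) (ℕP.≰⇒> j≰M)))))
    matched j j≤u (no j≰M) (no k≰N) = trans (restrict-≰ M f j j≰M) (sym (restrict-≰ N g (u ∸ j) k≰N))

module SeriesRing {c ℓ} (R : CommutativeRing c ℓ) where
  open CommutativeRing R
  open PowerSeries R
  open FiniteSums R
  open import Relation.Binary.Reasoning.Setoid setoid

  -ₛ_ : Series → Series
  (-ₛ A) n = - A n

  *ₛ-cong : ∀ {A A′ B B′} → A ≈ₛ A′ → B ≈ₛ B′ → (A *ₛ B) ≈ₛ (A′ *ₛ B′)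
  *ₛ-cong A≈ B≈ n = sumTo-cong n (λ i → *-cong (A≈ i) (B≈ (n ∸ i)))

  *ₛ-comm : ∀ A B → (A *ₛ B) ≈ₛ (B *ₛ A)
  *ₛ-comm A B n = trans (sumTo-reverse n _)
    (sumTo-cong≤ n (λ i i≤n → trans (*-comm _ _) (*-congʳ (reflexive (≡.cong B (ℕP.m∸[m∸n]≡n i≤n))))))

  *ₛ-assoc : ∀ A B C → ((A *ₛ B) *ₛ C) ≈ₛ (A *ₛ (B *ₛ C))
  *ₛ-assoc A B C n = begin
    sumTo n (λ k → sumTo k (λ i → A i * B (k ∸ i)) * C (n ∸ k))
      ≈⟨ sumTo-cong n (λ k → trans (*-comm _ _) (sym (sumTo-*ˡ k _ _))) ⟩
    sumTo n (λ k → sumTo k (λ i → C (n ∸ k) * (A i * B (k ∸ i))))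
      ≈⟨ sumTo-cong n (λ k → sumTo-cong≤ k (λ i i≤k → trans (*-comm _ _)
           (*-congˡ (reflexive (≡.cong C (n∸k≡[n∸i]∸[k∸i] i≤k)))))) ⟩
    sumTo n (λ k → sumTo k (λ i → A i * B (k ∸ i) * C ((n ∸ i) ∸ (k ∸ i))))
      ≈⟨ sumTo-antidiagonal n (λ i j → A i * B j * C ((n ∸ i) ∸ j)) ⟩
    sumTo n (λ i → sumTo (n ∸ i) (λ j → A i * B j * C ((n ∸ i) ∸ j)))
      ≈⟨ sumTo-cong n (λ i → trans (sumTo-cong (n ∸ i) (λ j → *-assoc _ _ _)) (sumTo-*ˡ (n ∸ i) _ _)) ⟩
    sumTo n (λ i → A i * (B *ₛ C) (n ∸ i)) ∎
    where
    n∸k≡[n∸i]∸[k∸i] : ∀ {i k} → i ≤ k → n ∸ k ≡ (n ∸ i) ∸ (k ∸ i)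
    n∸k≡[n∸i]∸[k∸i] {i} {k} i≤k =
      ≡.sym (≡.trans (ℕP.∸-+-assoc n i (k ∸ i)) (≡.cong (n ∸_) (ℕP.m+[n∸m]≡n i≤k)))

  *ₛ-identityˡ : ∀ A → (oneₛ *ₛ A) ≈ₛ A
  *ₛ-identityˡ A zero    = *-identityˡ _
  *ₛ-identityˡ A (suc n) = begin
    sumTo (suc n) (λ i → oneₛ i * A (suc n ∸ i))     ≈⟨ sumTo-sucˡ n _ ⟩
    1# * A (suc n) + sumTo n (λ i → 0# * A (n ∸ i))  ≈⟨ +-cong (*-identityˡ _) (sumTo-zero n (λ i _ → zeroˡ _)) ⟩
    A (suc n) + 0#                                   ≈⟨ +-identityʳ _ ⟩
    A (suc n)                                        ∎

  *ₛ-distribˡ : ∀ A B C → (A *ₛ (B +ₛ C)) ≈ₛ ((A *ₛ B) +ₛ (A *ₛ C))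
  *ₛ-distribˡ A B C n = trans (sumTo-cong n (λ i → distribˡ _ _ _)) (sumTo-+ n _ _)

  *ₛ-distribʳ : ∀ A B C → ((B +ₛ C) *ₛ A) ≈ₛ ((B *ₛ A) +ₛ (C *ₛ A))
  *ₛ-distribʳ A B C n = trans (sumTo-cong n (λ i → distribʳ _ _ _)) (sumTo-+ n _ _)

  seriesRing : CommutativeRing c ℓ
  seriesRing = record
    { Carrier = Series
    ; _≈_ = _≈ₛ_
    ; _+_ = _+ₛ_
    ; _*_ = _*ₛ_
    ; -_ = -ₛ_
    ; 0# = zeroₛ
    ; 1# = oneₛ
    ; isCommutativeRing = record
      { isRing = record
        { +-isAbelianGroup = record
          { isGroup = record
            { isMonoid = record
              { isSemigroup = record
                { isMagma = record
                  { isEquivalence = record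
                    { refl = λ n → refl ; sym = λ p n → sym (p n) ; trans = λ p q n → trans (p n) (q n) }
                  ; ∙-cong = λ p q n → +-cong (p n) (q n) }
                ; assoc = λ _ _ _ n → +-assoc _ _ _ }
              ; identity = (λ _ n → +-identityˡ _) , (λ _ n → +-identityʳ _) }
            ; inverse = (λ _ n → -‿inverseˡ _) , (λ _ n → -‿inverseʳ _)
            ; ⁻¹-cong = λ p n → -‿cong (p n) }
          ; comm = λ _ _ n → +-comm _ _ }
        ; *-cong = *ₛ-cong
        ; *-assoc = *ₛ-assoc
        ; *-identity = *ₛ-identityˡ , (λ A n → trans (*ₛ-comm A oneₛ n) (*ₛ-identityˡ A n))
        ; distrib = *ₛ-distribˡ , *ₛ-distribʳ }
      ; *-comm = *ₛ-comm } }

module SeriesCancellation {c ℓ} (R : CommutativeRing c ℓ) where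
  open CommutativeRing R
  open PowerSeries R
  open FiniteSums R

  *ₛ-≈0-cancelˡ : ∀ A B k → (A *ₛ B) ≈ₛ zeroₛ → A 0 * k ≈ 1# → B ≈ₛ zeroₛ
  *ₛ-≈0-cancelˡ A B k AB≈0 A₀k≈1 = <-rec _ coefficient
    where
    A₀-cancel : ∀ {x} → A 0 * x ≈ 0# → x ≈ 0#
    A₀-cancel {x} A₀x≈0 = trans (sym (*-identityˡ x)) (trans (*-congʳ (trans (sym A₀k≈1) (*-comm _ _)))
      (trans (*-assoc _ _ _) (trans (*-congˡ A₀x≈0) (zeroʳ _))))
    coefficient : ∀ n → (∀ {m} → m < n → B m ≈ 0#) → B n ≈ 0#
    coefficient zero    _     = A₀-cancel (AB≈0 0)
    coefficient (suc n) below = A₀-cancel (trans (sym (trans (sumTo-sucˡ n _)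
      (trans (+-congˡ (sumTo-zero n (λ i i≤n → trans (*-congˡ (below (s≤s (ℕP.m∸n≤m n i)))) (zeroʳ _))))
             (+-identityʳ _)))) (AB≈0 (suc n)))

module GuardedFixpoint {c ℓ} (X : Setoid c ℓ) (x₀ : Setoid.Carrier X)
  (F : (ℕ → Setoid.Carrier X) → (ℕ → Setoid.Carrier X))
  (guarded : ∀ V V′ q → (∀ p → p < q → Setoid._≈_ X (V p) (V′ p)) → Setoid._≈_ X (F V q) (F V′ q))
  where
  open Setoid X

  iterate : ℕ → ℕ → Carrier
  iterate zero    = λ _ → x₀
  iterate (suc k) = F (iterate k)

  fix : ℕ → Carrier
  fix q = iterate (suc q) q

  iterate-stable : ∀ k q → q < k → iterate k q ≈ iterate (suc k) q
  iterate-stable (suc k) q q<1+k = guarded (iterate k) (iterate (suc k)) q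
    (λ p p<q → iterate-stable k p (ℕP.<-≤-trans p<q (ℕP.≤-pred q<1+k)))

  iterate-settled : ∀ k p → p < k → iterate k p ≈ fix p
  iterate-settled (suc k) p (s≤s p≤k) with ℕP.m≤n⇒m<n∨m≡n p≤k
  ... | inj₂ ≡.refl = refl
  ... | inj₁ p<k    = trans (sym (iterate-stable k p p<k)) (iterate-settled k p p<k)

  fix-unfold : ∀ q → fix q ≈ F fix q
  fix-unfold q = guarded (iterate q) fix q (iterate-settled q)

  fix-unique : ∀ V → (∀ q → V q ≈ F V q) → ∀ q → V q ≈ fix q
  fix-unique V V≈FV = <-rec _ step
    where
    step : ∀ q → (∀ {p} → p < q → V p ≈ fix p) → V q ≈ fix q
    step q below = trans (V≈FV q) (trans (guarded V fix q (λ p → below)) (sym (fix-unfold q)))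

-- Integers represented as pairs (a , b) standing for a − b, in normal form so
-- that equality of coefficients is decidable; they serve as the coefficients of
-- Algebra.Solver.Ring over an arbitrary commutative ring.
module IntegerCoefficients where
  normalise : ℕ × ℕ → ℕ × ℕ
  normalise (a , b) = (a ∸ b , b ∸ a)

  normalise-sound : ∀ a b → (a ∸ b) +ℕ b ≡ a +ℕ (b ∸ a)
  normalise-sound a b with ℕP.≤-total a b
  ... | inj₁ a≤b = ≡.trans (≡.cong (_+ℕ b) (ℕP.m≤n⇒m∸n≡0 a≤b)) (≡.sym (ℕP.m+[n∸m]≡n a≤b))
  ... | inj₂ b≤a = ≡.trans (ℕP.m∸n+n≡m b≤a)
                   (≡.trans (≡.sym (ℕP.+-identityʳ a)) (≡.cong (a +ℕ_) (≡.sym (ℕP.m≤n⇒m∸n≡0 b≤a))))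

  ℤ-rawRing : RawRing _ _
  ℤ-rawRing = record
    { Carrier = ℕ × ℕ
    ; _≈_ = _≡_
    ; _+_ = λ { (a , b) (c , d) → normalise (a +ℕ c , b +ℕ d) }
    ; _*_ = λ { (a , b) (c , d) → normalise (a *ℕ c +ℕ b *ℕ d , a *ℕ d +ℕ b *ℕ c) }
    ; -_ = λ { (a , b) → (b , a) }
    ; 0# = (0 , 0)
    ; 1# = (1 , 0)
    }

module RingSolver {c ℓ} (R : CommutativeRing c ℓ) where
  open CommutativeRing R
  open PowerSeries R using (_·ℕ_)
  open IntegerCoefficients
  open import Algebra.Solver.Ring.AlmostCommutativeRing
    using (AlmostCommutativeRing; _-Raw-AlmostCommutative⟶_; fromCommutativeRing)
  open import Algebra.Properties.Semiring.Mult semiring using (×1-homo-*)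
  open import Algebra.Properties.Monoid.Mult +-monoid using (×-homo-+)
  open import Algebra.Properties.Ring ring using (-‿distribˡ-*; -‿distribʳ-*; -‿involutive; -‿+-comm; -0#≈0#)
  open import Relation.Binary.Reasoning.Setoid setoid

  ⟦_⟧ℤ : ℕ × ℕ → Carrier
  ⟦ (a , b) ⟧ℤ = a ·ℕ 1# - b ·ℕ 1#

  private
    sub-+ : ∀ x y z w → (x - y) + (z - w) ≈ (x + z) - (y + w)
    sub-+ x y z w = begin
      (x - y) + (z - w)        ≈⟨ +-assoc _ _ _ ⟩
      x + (- y + (z - w))      ≈⟨ +-congˡ (+-assoc _ _ _) ⟨
      x + ((- y + z) - w)      ≈⟨ +-congˡ (+-congʳ (+-comm _ _)) ⟩
      x + ((z - y) - w)        ≈⟨ +-congˡ (+-assoc _ _ _) ⟩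
      x + (z + (- y - w))      ≈⟨ +-assoc _ _ _ ⟨
      (x + z) + (- y - w)      ≈⟨ +-congˡ (-‿+-comm _ _) ⟩
      (x + z) - (y + w)        ∎

    sub-* : ∀ x y z w → (x - y) * (z - w) ≈ (x * z + y * w) - (x * w + y * z)
    sub-* x y z w = begin
      (x - y) * (z - w)                          ≈⟨ distribʳ _ _ _ ⟩
      x * (z - w) + - y * (z - w)                ≈⟨ +-cong (distribˡ _ _ _) (distribˡ _ _ _) ⟩
      (x * z + x * - w) + (- y * z + - y * - w)  ≈⟨ +-cong (+-congˡ (sym (-‿distribʳ-* _ _)))
                                                     (+-cong (sym (-‿distribˡ-* _ _))
                                                       (trans (sym (-‿distribˡ-* _ _))
                                                         (trans (-‿cong (sym (-‿distribʳ-* _ _))) (-‿involutive _)))) ⟩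
      (x * z - x * w) + (- (y * z) + y * w)      ≈⟨ +-congˡ (+-comm _ _) ⟩
      (x * z - x * w) + (y * w - y * z)          ≈⟨ sub-+ _ _ _ _ ⟩
      (x * z + y * w) - (x * w + y * z)          ∎

    ⟦⟧-cong : ∀ a b c d → a +ℕ d ≡ c +ℕ b → ⟦ (a , b) ⟧ℤ ≈ ⟦ (c , d) ⟧ℤ
    ⟦⟧-cong a b c d a+d≡c+b = begin
      N a - N b                    ≈⟨ +-identityʳ _ ⟨
      (N a - N b) + 0#             ≈⟨ +-congˡ (-‿inverseʳ (N d)) ⟨
      (N a - N b) + (N d - N d)    ≈⟨ sub-+ _ _ _ _ ⟩
      (N a + N d) - (N b + N d)    ≈⟨ +-cong (trans (sym (×-homo-+ 1# a d))
                                       (trans (reflexive (≡.cong N a+d≡c+b)) (×-homo-+ 1# c b)))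
                                       (-‿cong (+-comm _ _)) ⟩
      (N c + N b) - (N d + N b)    ≈⟨ sub-+ _ _ _ _ ⟨
      (N c - N d) + (N b - N b)    ≈⟨ +-congˡ (-‿inverseʳ _) ⟩
      (N c - N d) + 0#             ≈⟨ +-identityʳ _ ⟩
      N c - N d                    ∎
      where
      N : ℕ → Carrier
      N n = n ·ℕ 1#

    normalise-⟦⟧ : ∀ x → ⟦ normalise x ⟧ℤ ≈ ⟦ x ⟧ℤ
    normalise-⟦⟧ (a , b) = ⟦⟧-cong (a ∸ b) (b ∸ a) a b (normalise-sound a b)

    almostRing : AlmostCommutativeRing c ℓ
    almostRing = fromCommutativeRing R

    homomorphism : ℤ-rawRing -Raw-AlmostCommutative⟶ almostRing
    homomorphism = record
      { ⟦_⟧ = ⟦_⟧ℤ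
      ; +-homo = λ { (a , b) (c , d) → trans (normalise-⟦⟧ (a +ℕ c , b +ℕ d))
          (trans (+-cong (×-homo-+ 1# a c) (-‿cong (×-homo-+ 1# b d))) (sym (sub-+ _ _ _ _))) }
      ; *-homo = λ { (a , b) (c , d) → trans (normalise-⟦⟧ (a *ℕ c +ℕ b *ℕ d , a *ℕ d +ℕ b *ℕ c))
          (trans (+-cong (trans (×-homo-+ 1# (a *ℕ c) (b *ℕ d)) (+-cong (×1-homo-* a c) (×1-homo-* b d)))
                         (-‿cong (trans (×-homo-+ 1# (a *ℕ d) (b *ℕ c)) (+-cong (×1-homo-* a d) (×1-homo-* b c)))))
                 (sym (sub-* _ _ _ _))) }
      ; -‿homo = λ { (a , b) → sym (trans (-‿cong (+-comm _ _))
          (trans (sym (-‿+-comm _ _)) (+-congʳ (-‿involutive _)))) }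
      ; 0-homo = -‿inverseʳ _
      ; 1-homo = trans (+-congʳ (+-identityʳ _)) (trans (+-congˡ -0#≈0#) (+-identityʳ _))
      }

    ≟-coefficients : ∀ x y → Maybe (⟦ x ⟧ℤ ≈ ⟦ y ⟧ℤ)
    ≟-coefficients (a , b) (c , d) with a +ℕ d ≟ c +ℕ b
    ... | yes a+d≡c+b = just (⟦⟧-cong a b c d a+d≡c+b)
    ... | no  _       = nothing

  open import Algebra.Solver.Ring ℤ-rawRing almostRing homomorphism ≟-coefficients public

  ⟦1⟧ℤ≈1 : ⟦ (1 , 0) ⟧ℤ ≈ 1#
  ⟦1⟧ℤ≈1 = _-Raw-AlmostCommutative⟶_.1-homo homomorphism

module SeriesAlgebra {c ℓ} (K : CommutativeRing c ℓ) where
  open CommutativeRing K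
  open PowerSeries K
  open FiniteSums K

  module Ps = CommutativeRing (SeriesRing.seriesRing K)
  open RingSolver (SeriesRing.seriesRing K) public
    using () renaming (solve to solveₛ; _:+_ to _:+ₛ_; _:*_ to _:*ₛ_; _:-_ to _:-ₛ_; _:=_ to _:=ₛ_;
                       :-_ to :-ₛ_; con to conₛ; ⟦_⟧ℤ to ⟦_⟧ℤₛ; ⟦1⟧ℤ≈1 to ⟦1⟧ℤ≈oneₛ)
  open import Relation.Binary.Reasoning.Setoid Ps.setoid

  constₛ : Carrier → Series
  constₛ a = a ·ₛ oneₛ

  ·ₛ≈constₛ-*ₛ : ∀ a Y → (a ·ₛ Y) ≈ₛ (constₛ a *ₛ Y)
  ·ₛ≈constₛ-*ₛ a Y zero    = sym (*-congʳ (*-identityʳ a))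
  ·ₛ≈constₛ-*ₛ a Y (suc n) = sym (trans (sumTo-sucˡ n _) (trans (+-cong (*-congʳ (*-identityʳ a))
    (sumTo-zero n (λ i _ → trans (*-congʳ (zeroʳ a)) (zeroˡ _)))) (+-identityʳ _)))

  constₛ-+ : ∀ a b → constₛ (a + b) ≈ₛ (constₛ a +ₛ constₛ b)
  constₛ-+ a b n = distribʳ _ _ _

  constₛ-* : ∀ a b → constₛ (a * b) ≈ₛ (constₛ a *ₛ constₛ b)
  constₛ-* a b n = trans (*-assoc _ _ _) (·ₛ≈constₛ-*ₛ a (constₛ b) n)

  constₛ-1 : constₛ 1# ≈ₛ oneₛ
  constₛ-1 n = *-identityˡ _

  constₛ-0 : constₛ 0# ≈ₛ zeroₛ
  constₛ-0 n = zeroˡ _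

  constₛ-neg : ∀ a → constₛ (- a) ≈ₛ (Ps.- constₛ a)
  constₛ-neg a n = sym (-‿distribˡ-* a _)
    where open import Algebra.Properties.Ring ring using (-‿distribˡ-*)

  constₛ-cong : ∀ {a b} → a ≈ b → constₛ a ≈ₛ constₛ b
  constₛ-cong a≈b n = *-congʳ a≈b

  -ₛ≈-1·ₛ : ∀ f → (Ps.- f) ≈ₛ ((- 1#) ·ₛ f)
  -ₛ≈-1·ₛ f n = trans (-‿cong (sym (*-identityˡ (f n)))) (-‿distribˡ-* 1# (f n))
    where open import Algebra.Properties.Ring ring using (-‿distribˡ-*)

  _^ₛ_ : Series → ℕ → Series
  X ^ₛ zero  = oneₛ
  X ^ₛ suc n = X *ₛ (X ^ₛ n)

  ^ₛ-+ : ∀ X a b → (X ^ₛ (a +ℕ b)) ≈ₛ ((X ^ₛ a) *ₛ (X ^ₛ b))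
  ^ₛ-+ X zero    b = Ps.sym (Ps.*-identityˡ (X ^ₛ b))
  ^ₛ-+ X (suc a) b = Ps.trans (Ps.*-congˡ {X} (^ₛ-+ X a b)) (Ps.sym (Ps.*-assoc X (X ^ₛ a) (X ^ₛ b)))

  ^ₛ-*ₛ : ∀ X Y n → ((X *ₛ Y) ^ₛ n) ≈ₛ ((X ^ₛ n) *ₛ (Y ^ₛ n))
  ^ₛ-*ₛ X Y zero    = Ps.sym (Ps.*-identityˡ oneₛ)
  ^ₛ-*ₛ X Y (suc n) = Ps.trans (Ps.*-congˡ {X *ₛ Y} (^ₛ-*ₛ X Y n))
    (solveₛ 4 (λ x y a b → (x :*ₛ y) :*ₛ (a :*ₛ b) :=ₛ (x :*ₛ a) :*ₛ (y :*ₛ b)) Ps.refl X Y (X ^ₛ n) (Y ^ₛ n))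

  ^ₛ-oneₛ : ∀ {X} n → X ≈ₛ oneₛ → (X ^ₛ n) ≈ₛ oneₛ
  ^ₛ-oneₛ zero    X≈1 = Ps.refl
  ^ₛ-oneₛ (suc n) X≈1 = Ps.trans (Ps.*-cong X≈1 (^ₛ-oneₛ n X≈1)) (Ps.*-identityˡ oneₛ)

  addPoly : List Carrier → List Carrier → List Carrier
  addPoly []       q        = q
  addPoly (a ∷ p)  []       = a ∷ p
  addPoly (a ∷ p)  (b ∷ q)  = (a + b) ∷ addPoly p q

  scalePoly : Carrier → List Carrier → List Carrier
  scalePoly a = map (a *_)

  mulPoly : List Carrier → List Carrier → List Carrier
  mulPoly []      q = []
  mulPoly (a ∷ p) q = addPoly (scalePoly a q) (0# ∷ mulPoly p q)

  shiftPoly : ℕ → List Carrier → List Carrier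
  shiftPoly zero    p = p
  shiftPoly (suc k) p = 0# ∷ shiftPoly k p

  spreadPoly : List Carrier → List Carrier
  spreadPoly []      = []
  spreadPoly (a ∷ p) = a ∷ 0# ∷ spreadPoly p

  polyₛ-addPoly : ∀ p q X → polyₛ (addPoly p q) X ≈ₛ (polyₛ p X +ₛ polyₛ q X)
  polyₛ-addPoly []      q       X = Ps.sym (Ps.+-identityˡ (polyₛ q X))
  polyₛ-addPoly (a ∷ p) []      X = Ps.sym (Ps.+-identityʳ (polyₛ (a ∷ p) X))
  polyₛ-addPoly (a ∷ p) (b ∷ q) X = begin
    constₛ (a + b) +ₛ (X *ₛ polyₛ (addPoly p q) X)
      ≈⟨ Ps.+-cong (constₛ-+ a b) (Ps.*-congˡ {X} (polyₛ-addPoly p q X)) ⟩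
    (constₛ a +ₛ constₛ b) +ₛ (X *ₛ (polyₛ p X +ₛ polyₛ q X))
      ≈⟨ solveₛ 5 (λ a b x u v → (a :+ₛ b) :+ₛ (x :*ₛ (u :+ₛ v)) :=ₛ (a :+ₛ (x :*ₛ u)) :+ₛ (b :+ₛ (x :*ₛ v)))
           Ps.refl (constₛ a) (constₛ b) X (polyₛ p X) (polyₛ q X) ⟩
    (constₛ a +ₛ (X *ₛ polyₛ p X)) +ₛ (constₛ b +ₛ (X *ₛ polyₛ q X)) ∎

  polyₛ-scalePoly : ∀ a p X → polyₛ (scalePoly a p) X ≈ₛ (constₛ a *ₛ polyₛ p X)
  polyₛ-scalePoly a []      X = Ps.sym (Ps.zeroʳ (constₛ a))
  polyₛ-scalePoly a (b ∷ p) X = begin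
    constₛ (a * b) +ₛ (X *ₛ polyₛ (scalePoly a p) X)
      ≈⟨ Ps.+-cong (constₛ-* a b) (Ps.*-congˡ {X} (polyₛ-scalePoly a p X)) ⟩
    (constₛ a *ₛ constₛ b) +ₛ (X *ₛ (constₛ a *ₛ polyₛ p X))
      ≈⟨ solveₛ 4 (λ a b x u → (a :*ₛ b) :+ₛ (x :*ₛ (a :*ₛ u)) :=ₛ a :*ₛ (b :+ₛ (x :*ₛ u)))
           Ps.refl (constₛ a) (constₛ b) X (polyₛ p X) ⟩
    constₛ a *ₛ (constₛ b +ₛ (X *ₛ polyₛ p X)) ∎

  polyₛ-cons0 : ∀ p X → polyₛ (0# ∷ p) X ≈ₛ (X *ₛ polyₛ p X)
  polyₛ-cons0 p X = Ps.trans (Ps.+-congʳ {X *ₛ polyₛ p X} constₛ-0) (Ps.+-identityˡ (X *ₛ polyₛ p X))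

  polyₛ-single : ∀ a X → polyₛ (a ∷ []) X ≈ₛ constₛ a
  polyₛ-single a X = Ps.trans (Ps.+-congˡ {constₛ a} (Ps.zeroʳ X)) (Ps.+-identityʳ (constₛ a))

  polyₛ-mulPoly : ∀ p q X → polyₛ (mulPoly p q) X ≈ₛ (polyₛ p X *ₛ polyₛ q X)
  polyₛ-mulPoly []      q X = Ps.sym (Ps.zeroˡ (polyₛ q X))
  polyₛ-mulPoly (a ∷ p) q X = begin
    polyₛ (addPoly (scalePoly a q) (0# ∷ mulPoly p q)) X
      ≈⟨ polyₛ-addPoly (scalePoly a q) (0# ∷ mulPoly p q) X ⟩
    polyₛ (scalePoly a q) X +ₛ polyₛ (0# ∷ mulPoly p q) X
      ≈⟨ Ps.+-cong (polyₛ-scalePoly a q X) (Ps.trans (polyₛ-cons0 (mulPoly p q) X) (Ps.*-congˡ {X} (polyₛ-mulPoly p q X))) ⟩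
    (constₛ a *ₛ polyₛ q X) +ₛ (X *ₛ (polyₛ p X *ₛ polyₛ q X))
      ≈⟨ solveₛ 4 (λ a x u v → (a :*ₛ v) :+ₛ (x :*ₛ (u :*ₛ v)) :=ₛ (a :+ₛ (x :*ₛ u)) :*ₛ v)
           Ps.refl (constₛ a) X (polyₛ p X) (polyₛ q X) ⟩
    (constₛ a +ₛ (X *ₛ polyₛ p X)) *ₛ polyₛ q X ∎

  polyₛ-shiftPoly : ∀ k p X → polyₛ (shiftPoly k p) X ≈ₛ ((X ^ₛ k) *ₛ polyₛ p X)
  polyₛ-shiftPoly zero    p X = Ps.sym (Ps.*-identityˡ (polyₛ p X))
  polyₛ-shiftPoly (suc k) p X = Ps.trans (polyₛ-cons0 (shiftPoly k p) X)
    (Ps.trans (Ps.*-congˡ {X} (polyₛ-shiftPoly k p X)) (Ps.sym (Ps.*-assoc X (X ^ₛ k) (polyₛ p X))))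

  polyₛ-spreadPoly : ∀ p X → polyₛ (spreadPoly p) X ≈ₛ polyₛ p (X *ₛ X)
  polyₛ-spreadPoly []      X = Ps.refl
  polyₛ-spreadPoly (a ∷ p) X = Ps.+-congˡ {constₛ a} (Ps.trans
    (Ps.*-congˡ {X} (Ps.trans (polyₛ-cons0 (spreadPoly p) X) (Ps.*-congˡ {X} (polyₛ-spreadPoly p X))))
    (Ps.sym (Ps.*-assoc X X (polyₛ p (X *ₛ X)))))

module _ {c ℓ} (K : CommutativeRing c ℓ) where
  open CommutativeRing K
  open PowerSeries K

  module FieldLemmas (isField : IsField) where
    open import Relation.Binary.Reasoning.Setoid setoid

    inverse : ∀ x → ¬ (x ≈ 0#) → Carrier
    inverse x x≉0 = proj₁ (proj₂ isField x x≉0)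

    *-inverseʳ : ∀ x x≉0 → x * inverse x x≉0 ≈ 1#
    *-inverseʳ x x≉0 = proj₂ (proj₂ isField x x≉0)

    *-cancelˡ-≈0 : ∀ {x y} → ¬ (x ≈ 0#) → x * y ≈ 0# → y ≈ 0#
    *-cancelˡ-≈0 {x} {y} x≉0 xy≈0 = begin
      y                      ≈⟨ *-identityˡ y ⟨
      1# * y                 ≈⟨ *-congʳ (trans (*-comm _ _) (*-inverseʳ x x≉0)) ⟨
      (inverse x x≉0 * x) * y ≈⟨ *-assoc _ x y ⟩
      inverse x x≉0 * (x * y) ≈⟨ *-congˡ xy≈0 ⟩
      inverse x x≉0 * 0#     ≈⟨ zeroʳ _ ⟩
      0#                     ∎

    *-≉0 : ∀ {x y} → ¬ (x ≈ 0#) → ¬ (y ≈ 0#) → ¬ (x * y ≈ 0#)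
    *-≉0 x≉0 y≉0 xy≈0 = y≉0 (*-cancelˡ-≈0 x≉0 xy≈0)

    1≉0 : ¬ (1# ≈ 0#)
    1≉0 = proj₁ isField

module _ {c ℓ} (K : CommutativeRing c ℓ) where
  open CommutativeRing K
  open PowerSeries K

  module Solution (Λ : Series) where
    open FiniteSums K

    AgreeUpTo : ℕ → Series₂ → Series₂ → Set ℓ
    AgreeUpTo m A B = ∀ n m′ → m′ ≤ m → A n m′ ≈ B n m′

    pow₂-local : ∀ {A B} j m → AgreeUpTo m A B → ∀ n → pow₂ A j n m ≈ pow₂ B j n m
    pow₂-local zero    m A≈B n = refl
    pow₂-local (suc j) m A≈B n = sumTo-cong n (λ i → sumTo-cong≤ m (λ k k≤m →
      *-cong (A≈B i k k≤m)
             (pow₂-local j (m ∸ k) (λ n′ m′ m′≤ → A≈B n′ m′ (ℕP.≤-trans m′≤ (ℕP.m∸n≤m m k))) (n ∸ i))))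

    compose-local : ∀ {A B} m → AgreeUpTo m A B → ∀ n → compose Λ A n m ≈ compose Λ B n m
    compose-local m A≈B n = sumTo-cong (n +ℕ m) (λ j → *-congˡ (pow₂-local j m A≈B n))

    rhs-zero : ∀ A B n → rhs Λ A n 0 ≈ rhs Λ B n 0
    rhs-zero A B zero          = refl
    rhs-zero A B (suc zero)    = refl
    rhs-zero A B (suc (suc n)) = refl

    rhs-suc : ∀ A n m → rhs Λ A n (suc m) ≈ compose Λ A n m
    rhs-suc A zero          m = refl
    rhs-suc A (suc zero)    m = refl
    rhs-suc A (suc (suc n)) m = refl

    -- The solution is built column by column: column m of  t + kΛ(H)  only
    -- involves the columns of H below m.
    private
      step : (ℕ → Series) → (ℕ → Series)
      step V m n = rhs Λ (λ n′ m′ → V m′ n′) n m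

      step-guarded : ∀ V V′ m → (∀ p → p < m → V p ≈ₛ V′ p) → step V m ≈ₛ step V′ m
      step-guarded V V′ zero    _    n = rhs-zero _ _ n
      step-guarded V V′ (suc m) V≈V′ n = begin
        rhs Λ _ n (suc m)  ≈⟨ rhs-suc _ n m ⟩
        compose Λ _ n m    ≈⟨ compose-local m (λ n′ m′ m′≤m → V≈V′ m′ (s≤s m′≤m) n′) n ⟩
        compose Λ _ n m    ≈⟨ rhs-suc _ n m ⟨
        rhs Λ _ n (suc m)  ∎
        where open import Relation.Binary.Reasoning.Setoid setoid

    open GuardedFixpoint (CommutativeRing.setoid (SeriesRing.seriesRing K)) zeroₛ step step-guarded
      using (fix; fix-unfold; fix-unique)

    H : Series₂
    H n m = fix m n

    H-solution : IsSolution Λ H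
    H-solution = refl , λ n m → fix-unfold m n

    H-unique : ∀ H′ → IsSolution Λ H′ → H′ ≈₂ H
    H-unique H′ (_ , H′≈rhs) n m = fix-unique (λ m n → H′ n m) (λ m n → H′≈rhs n m) m n

module Support {c ℓ} (K : CommutativeRing c ℓ) where
  open CommutativeRing K
  open PowerSeries K
  open FiniteSums K

  SupportAbove : ℕ → Series₂ → Set ℓ
  SupportAbove a A = ∀ n m → n < m +ℕ a → A n m ≈ 0#

  one₂-support : SupportAbove 0 one₂
  one₂-support zero    zero    ()
  one₂-support zero    (suc m) _ = refl
  one₂-support (suc n) m       _ = refl

  *₂-support : ∀ a b {A B} → SupportAbove a A → SupportAbove b B → SupportAbove (a +ℕ b) (A *₂ B)
  *₂-support a b {A} {B} A-supp B-supp n m n<m+a+b =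
    sumTo-zero n (λ i i≤n → sumTo-zero m (λ j j≤m → term i j i≤n j≤m))
    where
    term : ∀ i j → i ≤ n → j ≤ m → A i j * B (n ∸ i) (m ∸ j) ≈ 0#
    term i j i≤n j≤m with i <? j +ℕ a
    ... | yes i<j+a = trans (*-congʳ (A-supp i j i<j+a)) (zeroˡ _)
    ... | no  i≮j+a = trans (*-congˡ (B-supp (n ∸ i) (m ∸ j) (rest-below (ℕP.≮⇒≥ i≮j+a)))) (zeroʳ _)
      where
      open ℕP.≤-Reasoning
      rest-below : j +ℕ a ≤ i → n ∸ i < (m ∸ j) +ℕ b
      rest-below j+a≤i = ℕP.+-cancelʳ-< i _ _ (begin-strict
        (n ∸ i) +ℕ i                  ≡⟨ ℕP.m∸n+n≡m i≤n ⟩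
        n                             <⟨ n<m+a+b ⟩
        m +ℕ (a +ℕ b)                 ≡⟨ ≡.cong (_+ℕ (a +ℕ b)) (ℕP.m∸n+n≡m j≤m) ⟨
        ((m ∸ j) +ℕ j) +ℕ (a +ℕ b)    ≡⟨ rearrange (m ∸ j) j a b ⟩
        ((m ∸ j) +ℕ b) +ℕ (j +ℕ a)    ≤⟨ ℕP.+-monoʳ-≤ ((m ∸ j) +ℕ b) j+a≤i ⟩
        ((m ∸ j) +ℕ b) +ℕ i           ∎)
        where
        rearrange : ∀ x y a b → (x +ℕ y) +ℕ (a +ℕ b) ≡ (x +ℕ b) +ℕ (y +ℕ a)
        rearrange = solve-∀

  pow₂-support : ∀ {A} → SupportAbove 1 A → ∀ j → SupportAbove j (pow₂ A j)
  pow₂-support A-supp zero    = one₂-support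
  pow₂-support A-supp (suc j) = *₂-support 1 j A-supp (pow₂-support A-supp j)

module _ {c ℓ} (K : CommutativeRing c ℓ) where
  open CommutativeRing K
  open PowerSeries K

  module SolutionSupport (Λ : Series) (Λ₀≈0 : Λ 0 ≈ 0#) (Λ₁≈0 : Λ 1 ≈ 0#) where
    open FiniteSums K
    open Solution K Λ
    open Support K

    truncate : ℕ → Series₂ → Series₂
    truncate m A n k with k ≤? m
    ... | yes _ = A n k
    ... | no  _ = 0#

    truncate-agrees : ∀ m A → AgreeUpTo m A (truncate m A)
    truncate-agrees m A n k k≤m with k ≤? m
    ... | yes _   = refl
    ... | no  k≰m = ⊥-elim (k≰m k≤m)

    -- Column m + 1 of kΛ(H) only involves the columns ≤ m of H, and there Λ₀ = Λ₁ = 0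
    -- while every Hʲ with j ≥ 2 vanishes below the line n = m + 2.
    H-column-support : ∀ m n → n < m +ℕ 1 → H n m ≈ 0#
    H-column-support = <-rec _ column
      where
      column : ∀ m → (∀ {k} → k < m → ∀ n → n < k +ℕ 1 → H n k ≈ 0#) → ∀ n → n < m +ℕ 1 → H n m ≈ 0#
      column zero    _     zero    _         = proj₁ H-solution
      column zero    _     (suc n) (s≤s ())
      column (suc m) below n       n<m+2     = begin
        H n (suc m)                           ≈⟨ proj₂ H-solution n (suc m) ⟩
        rhs Λ H n (suc m)                     ≈⟨ rhs-suc H n m ⟩
        compose Λ H n m                       ≈⟨ compose-local m (truncate-agrees m H) n ⟩
        compose Λ (truncate m H) n m          ≈⟨ sumTo-zero (n +ℕ m) term ⟩
        0#                                    ∎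
        where
        open import Relation.Binary.Reasoning.Setoid setoid
        truncate-support : SupportAbove 1 (truncate m H)
        truncate-support n′ k n′<k+1 with k ≤? m
        ... | yes k≤m = below (s≤s k≤m) n′ n′<k+1
        ... | no  _   = refl
        term : ∀ j → j ≤ n +ℕ m → Λ j * pow₂ (truncate m H) j n m ≈ 0#
        term zero          _ = trans (*-congʳ Λ₀≈0) (zeroˡ _)
        term (suc zero)    _ = trans (*-congʳ Λ₁≈0) (zeroˡ _)
        term (suc (suc j)) _ = trans (*-congˡ (pow₂-support truncate-support (suc (suc j)) n m
          (ℕP.<-≤-trans n<m+2 m+2≤m+[2+j]))) (zeroʳ _)
          where
          m+2≤m+[2+j] : suc m +ℕ 1 ≤ m +ℕ suc (suc j)
          m+2≤m+[2+j] = ℕP.≤-trans (ℕP.≤-reflexive (≡.sym (ℕP.+-suc m 1))) (ℕP.+-monoʳ-≤ m (s≤s (s≤s z≤n)))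

    H-support : SupportAbove 1 H
    H-support n m = H-column-support m n

module DiagonalArithmetic where
  open ℕP.≤-Reasoning

  ∸-< : ∀ {x y z} → y ≤ x → x < y +ℕ z → x ∸ y < z
  ∸-< {x} {y} {z} y≤x x<y+z = ℕP.+-cancelʳ-< y _ _ (begin-strict
    (x ∸ y) +ℕ y  ≡⟨ ℕP.m∸n+n≡m y≤x ⟩
    x             <⟨ x<y+z ⟩
    y +ℕ z        ≡⟨ ℕP.+-comm y z ⟩
    z +ℕ y        ∎)

  a+[u∸j]≤u+a : ∀ u a j → a +ℕ (u ∸ j) ≤ u +ℕ a
  a+[u∸j]≤u+a u a j = ≡.subst (a +ℕ (u ∸ j) ≤_) (ℕP.+-comm a u) (ℕP.+-monoʳ-≤ a (ℕP.m∸n≤m u j))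

  [u+a]∸[a+[u∸j]]≡j : ∀ {u a j} → j ≤ u → (u +ℕ a) ∸ (a +ℕ (u ∸ j)) ≡ j
  [u+a]∸[a+[u∸j]]≡j {u} {a} {j} j≤u = ≡.trans
    (≡.cong (λ z → (z +ℕ a) ∸ (a +ℕ (u ∸ j))) (≡.sym (ℕP.m∸n+n≡m j≤u)))
    (≡.trans (≡.cong (_∸ (a +ℕ (u ∸ j))) (shuffle (u ∸ j) j a)) (ℕP.m+n∸m≡n (a +ℕ (u ∸ j)) j))
    where
    shuffle : ∀ d j a → d +ℕ j +ℕ a ≡ (a +ℕ d) +ℕ j
    shuffle = solve-∀

  n∸i<b+[q∸r] : ∀ {n i a b q r} → r ≤ q → a +ℕ r ≤ i → i ≤ n → n < a +ℕ b +ℕ q → n ∸ i < b +ℕ (q ∸ r)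
  n∸i<b+[q∸r] {n} {i} {a} {b} {q} {r} r≤q a+r≤i i≤n n<a+b+q = ∸-< i≤n (begin-strict
    n                             <⟨ n<a+b+q ⟩
    a +ℕ b +ℕ q                   ≡⟨ ≡.cong (a +ℕ b +ℕ_) (ℕP.m∸n+n≡m r≤q) ⟨
    a +ℕ b +ℕ ((q ∸ r) +ℕ r)      ≡⟨ shuffle a b (q ∸ r) r ⟩
    (a +ℕ r) +ℕ (b +ℕ (q ∸ r))    ≤⟨ ℕP.+-monoˡ-≤ _ a+r≤i ⟩
    i +ℕ (b +ℕ (q ∸ r))           ∎)
    where
    shuffle : ∀ a b e r → a +ℕ b +ℕ (e +ℕ r) ≡ (a +ℕ r) +ℕ (b +ℕ e)
    shuffle = solve-∀

  -- The index bookkeeping of the double sum defining a coefficient of a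
  -- product, at  tⁿ k^m  with  n = m + (a + b + q)  and  i = u + a.
  n∸i≡[b+[q∸[u∸j]]]+[m∸j] : ∀ {n i m u a b q j} → n ≡ m +ℕ (a +ℕ b +ℕ q) → i ≡ u +ℕ a →
    j ≤ m → j ≤ u → u ∸ j ≤ q → n ∸ i ≡ (b +ℕ (q ∸ (u ∸ j))) +ℕ (m ∸ j)
  n∸i≡[b+[q∸[u∸j]]]+[m∸j] {m = m} {u} {a} {b} {q} {j} ≡.refl ≡.refl j≤m j≤u u∸j≤q = ≡.trans
    (split (ℕP.m∸n+n≡m j≤m) (ℕP.m∸n+n≡m j≤u) (ℕP.m+[n∸m]≡n u∸j≤q))
    (≡.trans (≡.cong (_∸ ((d +ℕ j) +ℕ a)) (shuffle (m ∸ j) j a b d (q ∸ d)))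
             (ℕP.m+n∸m≡n ((d +ℕ j) +ℕ a) ((b +ℕ (q ∸ d)) +ℕ (m ∸ j))))
    where
    d = u ∸ j
    split : ∀ {x x′ y y′ z z′} → x′ ≡ x → y′ ≡ y → z′ ≡ z →
      (x +ℕ (a +ℕ b +ℕ z)) ∸ (y +ℕ a) ≡ (x′ +ℕ (a +ℕ b +ℕ z′)) ∸ (y′ +ℕ a)
    split ≡.refl ≡.refl ≡.refl = ≡.refl
    shuffle : ∀ g j a b d e → (g +ℕ j) +ℕ (a +ℕ b +ℕ (d +ℕ e)) ≡ ((d +ℕ j) +ℕ a) +ℕ ((b +ℕ e) +ℕ g)
    shuffle = solve-∀

  module _ {n i m u a b q : ℕ} (n≡ : n ≡ m +ℕ (a +ℕ b +ℕ q)) (i≡ : i ≡ u +ℕ a) where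

    q<u∸j⇒n∸i<[m∸j]+b : ∀ {j} → i ≤ n → j ≤ m → j ≤ u → q < u ∸ j → n ∸ i < (m ∸ j) +ℕ b
    q<u∸j⇒n∸i<[m∸j]+b {j} i≤n j≤m j≤u q<u∸j = ∸-< i≤n (begin-strict
      n                                    ≡⟨ n≡ ⟩
      m +ℕ (a +ℕ b +ℕ q)                   ≡⟨ ≡.cong (_+ℕ (a +ℕ b +ℕ q)) (ℕP.m∸n+n≡m j≤m) ⟨
      ((m ∸ j) +ℕ j) +ℕ (a +ℕ b +ℕ q)      ≡⟨ shuffle (m ∸ j) j a b q ⟩
      (m ∸ j) +ℕ b +ℕ q +ℕ j +ℕ a          <⟨ ℕP.+-monoˡ-< a (ℕP.+-monoˡ-< j (ℕP.+-monoʳ-< ((m ∸ j) +ℕ b) q<u∸j)) ⟩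
      (m ∸ j) +ℕ b +ℕ (u ∸ j) +ℕ j +ℕ a    ≡⟨ shuffle′ (m ∸ j) j a b (u ∸ j) ⟩
      ((u ∸ j) +ℕ j) +ℕ a +ℕ ((m ∸ j) +ℕ b) ≡⟨ ≡.cong (λ z → z +ℕ a +ℕ ((m ∸ j) +ℕ b)) (ℕP.m∸n+n≡m j≤u) ⟩
      u +ℕ a +ℕ ((m ∸ j) +ℕ b)             ≡⟨ ≡.cong (_+ℕ ((m ∸ j) +ℕ b)) i≡ ⟨
      i +ℕ ((m ∸ j) +ℕ b)                  ∎)
      where
      shuffle : ∀ g j a b q → (g +ℕ j) +ℕ (a +ℕ b +ℕ q) ≡ g +ℕ b +ℕ q +ℕ j +ℕ a
      shuffle = solve-∀
      shuffle′ : ∀ g j a b d → g +ℕ b +ℕ d +ℕ j +ℕ a ≡ (d +ℕ j) +ℕ a +ℕ (g +ℕ b)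
      shuffle′ = solve-∀

    m<u∸r⇒n∸i<b+[q∸r] : ∀ {r} → i ≤ n → r ≤ q → r ≤ u → m < u ∸ r → n ∸ i < b +ℕ (q ∸ r)
    m<u∸r⇒n∸i<b+[q∸r] {r} i≤n r≤q r≤u m<u∸r = ∸-< i≤n (begin-strict
      n                                     ≡⟨ n≡ ⟩
      m +ℕ (a +ℕ b +ℕ q)                    ≡⟨ ≡.cong (λ z → m +ℕ (a +ℕ b +ℕ z)) (ℕP.m∸n+n≡m r≤q) ⟨
      m +ℕ (a +ℕ b +ℕ ((q ∸ r) +ℕ r))       ≡⟨ shuffle m a b (q ∸ r) r ⟩
      m +ℕ (a +ℕ b +ℕ (q ∸ r) +ℕ r)         <⟨ ℕP.+-monoˡ-< _ m<u∸r ⟩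
      (u ∸ r) +ℕ (a +ℕ b +ℕ (q ∸ r) +ℕ r)   ≡⟨ shuffle′ (u ∸ r) r a b (q ∸ r) ⟩
      ((u ∸ r) +ℕ r) +ℕ a +ℕ (b +ℕ (q ∸ r)) ≡⟨ ≡.cong (λ z → z +ℕ a +ℕ (b +ℕ (q ∸ r))) (ℕP.m∸n+n≡m r≤u) ⟩
      u +ℕ a +ℕ (b +ℕ (q ∸ r))              ≡⟨ ≡.cong (_+ℕ (b +ℕ (q ∸ r))) i≡ ⟨
      i +ℕ (b +ℕ (q ∸ r))                   ∎)
      where
      shuffle : ∀ m a b e r → m +ℕ (a +ℕ b +ℕ (e +ℕ r)) ≡ m +ℕ (a +ℕ b +ℕ e +ℕ r)
      shuffle = solve-∀
      shuffle′ : ∀ d r a b e → d +ℕ (a +ℕ b +ℕ e +ℕ r) ≡ (d +ℕ r) +ℕ a +ℕ (b +ℕ e)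
      shuffle′ = solve-∀

module DiagonalProduct {c ℓ} (K : CommutativeRing c ℓ) where
  open CommutativeRing K
  open PowerSeries K
  open FiniteSums K
  open SumReflection K
  open Support K
  open DiagonalArithmetic

  diagonal-≤ : ∀ A l n → l ≤ n → diagonal A l n ≈ A n (n ∸ l)
  diagonal-≤ A l n l≤n with l ≤? n
  ... | yes _   = refl
  ... | no  l≰n = ⊥-elim (l≰n l≤n)

  diagonal-≰ : ∀ A l n → ¬ (l ≤ n) → diagonal A l n ≈ 0#
  diagonal-≰ A l n l≰n with l ≤? n
  ... | yes l≤n = ⊥-elim (l≰n l≤n)
  ... | no  _   = refl

  module _ (a b : ℕ) {A B : Series₂} (A-supp : SupportAbove a A) (B-supp : SupportAbove b B) (q n : ℕ) where

    cross : ℕ → ℕ → Carrier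
    cross r i = diagonal A (a +ℕ r) i * diagonal B (b +ℕ (q ∸ r)) (n ∸ i)

    cross-short : ¬ (a +ℕ b +ℕ q ≤ n) → ∀ r i → r ≤ q → i ≤ n → Dec (a +ℕ r ≤ i) → cross r i ≈ 0#
    cross-short L≰n r i r≤q i≤n (yes a+r≤i) =
      trans (*-congˡ (diagonal-≰ B _ _ (ℕP.<⇒≱ (n∸i<b+[q∸r] r≤q a+r≤i i≤n (ℕP.≰⇒> L≰n))))) (zeroʳ _)
    cross-short L≰n r i r≤q i≤n (no a+r≰i) = trans (*-congʳ (diagonal-≰ A _ _ a+r≰i)) (zeroˡ _)

    column-below : ∀ m i → ¬ (a ≤ i) → sumTo m (λ j → A i j * B (n ∸ i) (m ∸ j)) ≈ sumTo q (λ r → cross r i)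
    column-below m i a≰i = trans
      (sumTo-zero m (λ j _ → trans (*-congʳ (A-supp i j (ℕP.<-≤-trans (ℕP.≰⇒> a≰i) (ℕP.m≤n+m a j)))) (zeroˡ _)))
      (sym (sumTo-zero q (λ r _ → trans (*-congʳ (diagonal-≰ A _ _ (λ a+r≤i → a≰i (ℕP.m+n≤o⇒m≤o a a+r≤i)))) (zeroˡ _))))

    -- Term (i, j) on the left is term (i, r) on the right with r = i − a − j.
    column : ∀ m → n ≡ m +ℕ (a +ℕ b +ℕ q) → ∀ i → i ≤ n → a ≤ i →
      sumTo m (λ j → A i j * B (n ∸ i) (m ∸ j)) ≈ sumTo q (λ r → cross r i)
    column m n≡ i i≤n a≤i = sumTo-reflect m q u A-beyond B-beyond diagA-beyond diagB-beyond matched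
      where
      u = i ∸ a
      i≡ : i ≡ u +ℕ a
      i≡ = ≡.sym (ℕP.m∸n+n≡m a≤i)
      A-beyond : ∀ j → j ≤ m → u < j → A i j * B (n ∸ i) (m ∸ j) ≈ 0#
      A-beyond j _ u<j = trans (*-congʳ (A-supp i j (≡.subst (_< j +ℕ a) (≡.sym i≡) (ℕP.+-monoˡ-< a u<j)))) (zeroˡ _)
      B-beyond : ∀ j → j ≤ m → j ≤ u → q < u ∸ j → A i j * B (n ∸ i) (m ∸ j) ≈ 0#
      B-beyond j j≤m j≤u q<u∸j = trans (*-congˡ (B-supp _ _ (q<u∸j⇒n∸i<[m∸j]+b n≡ i≡ i≤n j≤m j≤u q<u∸j))) (zeroʳ _)
      diagA-beyond : ∀ r → r ≤ q → u < r → cross r i ≈ 0#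
      diagA-beyond r _ u<r = trans (*-congʳ (diagonal-≰ A _ _ (ℕP.<⇒≱
        (≡.subst₂ _<_ (≡.sym i≡) (ℕP.+-comm r a) (ℕP.+-monoˡ-< a u<r))))) (zeroˡ _)
      diagB-beyond : ∀ r → r ≤ q → r ≤ u → m < u ∸ r → cross r i ≈ 0#
      diagB-beyond r r≤q r≤u m<u∸r = trans (*-congˡ (diagonal-≰ B _ _ (ℕP.<⇒≱
        (m<u∸r⇒n∸i<b+[q∸r] n≡ i≡ i≤n r≤q r≤u m<u∸r)))) (zeroʳ _)
      matched : ∀ j → j ≤ m → j ≤ u → u ∸ j ≤ q → A i j * B (n ∸ i) (m ∸ j) ≈ cross (u ∸ j) i
      matched j j≤m j≤u u∸j≤q = sym (*-cong
        (trans (diagonal-≤ A (a +ℕ (u ∸ j)) i A-index≤) (reflexive (≡.cong (A i) A-index)))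
        (trans (diagonal-≤ B (b +ℕ (q ∸ (u ∸ j))) (n ∸ i) B-index≤) (reflexive (≡.cong (B (n ∸ i)) B-index))))
        where
        A-index≤ : a +ℕ (u ∸ j) ≤ i
        A-index≤ = ≡.subst (a +ℕ (u ∸ j) ≤_) (≡.sym i≡) (a+[u∸j]≤u+a u a j)
        A-index : i ∸ (a +ℕ (u ∸ j)) ≡ j
        A-index = ≡.subst (λ i → i ∸ (a +ℕ (u ∸ j)) ≡ j) (≡.sym i≡) ([u+a]∸[a+[u∸j]]≡j {u} {a} j≤u)
        n∸i≡ : n ∸ i ≡ (b +ℕ (q ∸ (u ∸ j))) +ℕ (m ∸ j)
        n∸i≡ = n∸i≡[b+[q∸[u∸j]]]+[m∸j] n≡ i≡ j≤m j≤u u∸j≤q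
        B-index≤ : b +ℕ (q ∸ (u ∸ j)) ≤ n ∸ i
        B-index≤ = ≡.subst (b +ℕ (q ∸ (u ∸ j)) ≤_) (≡.sym n∸i≡) (ℕP.m≤m+n _ (m ∸ j))
        B-index : (n ∸ i) ∸ (b +ℕ (q ∸ (u ∸ j))) ≡ m ∸ j
        B-index = ≡.trans (≡.cong (_∸ (b +ℕ (q ∸ (u ∸ j)))) n∸i≡) (ℕP.m+n∸m≡n (b +ℕ (q ∸ (u ∸ j))) (m ∸ j))

  -- Diagonals multiply like Laurent series in k⁻¹.
  diagonal-*₂ : ∀ a b {A B} → SupportAbove a A → SupportAbove b B → ∀ q n →
    diagonal (A *₂ B) (a +ℕ b +ℕ q) n ≈ sumTo q (λ r → (diagonal A (a +ℕ r) *ₛ diagonal B (b +ℕ (q ∸ r))) n)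
  diagonal-*₂ a b {A} {B} A-supp B-supp q n = by-cases ((a +ℕ b +ℕ q) ≤? n)
    where
    by-cases : Dec (a +ℕ b +ℕ q ≤ n) → diagonal (A *₂ B) (a +ℕ b +ℕ q) n ≈ sumTo q (λ r → sumTo n (cross a b A-supp B-supp q n r))
    by-cases (no L≰n) = trans (diagonal-≰ (A *₂ B) _ n L≰n) (sym (sumTo-zero q (λ r r≤q → sumTo-zero n (λ i i≤n →
      cross-short a b A-supp B-supp q n L≰n r i r≤q i≤n (a +ℕ r ≤? i)))))
    by-cases (yes L≤n) = trans (diagonal-≤ (A *₂ B) _ n L≤n)
      (trans (sumTo-cong≤ n (λ i i≤n → by-column i i≤n (a ≤? i))) (sym (sumTo-swap q n _)))
      where
      m = n ∸ (a +ℕ b +ℕ q)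
      by-column : ∀ i → i ≤ n → Dec (a ≤ i) →
        sumTo m (λ j → A i j * B (n ∸ i) (m ∸ j)) ≈ sumTo q (λ r → cross a b A-supp B-supp q n r i)
      by-column i i≤n (yes a≤i) = column a b A-supp B-supp q n m (≡.sym (ℕP.m∸n+n≡m L≤n)) i i≤n a≤i
      by-column i i≤n (no a≰i)  = column-below a b A-supp B-supp q n m i a≰i

-- A family of series indexed by q stands for the series  Σ_q V_q uᑫ  in an
-- auxiliary variable u whose coefficients are series in t.
module Slices {c ℓ} (K : CommutativeRing c ℓ) where
  open CommutativeRing K
  open PowerSeries K

  sliceRing : CommutativeRing c ℓ
  sliceRing = SeriesRing.seriesRing (SeriesRing.seriesRing K)

  module 𝕊 = CommutativeRing sliceRing
  module ℙ = PowerSeries (SeriesRing.seriesRing K)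

  Slices : Set c
  Slices = ℕ → Series

  _^_ : Slices → ℕ → Slices
  V ^ zero  = 𝕊.1#
  V ^ suc j = V 𝕊.* (V ^ j)

  ℙ-sumTo-at : ∀ q (F : ℕ → Series) n → ℙ.sumTo q F n ≈ sumTo q (λ r → F r n)
  ℙ-sumTo-at zero    F n = refl
  ℙ-sumTo-at (suc q) F n = +-congʳ (ℙ-sumTo-at q F n)

  tSlice : Slices
  tSlice zero    = tₛ
  tSlice (suc _) = zeroₛ

  -- Φ Λ Z = Σⱼ λⱼ₊₂ uʲ Zⱼ₊₂ ; with Zⱼ = Vʲ this is Σⱼ λⱼ u^(j-2) Vʲ.
  Φ : Series → (ℕ → Slices) → Slices
  Φ Λ Z q n = sumTo q (λ j → Λ (2 +ℕ j) * Z (2 +ℕ j) (q ∸ j) n)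

  SliceEquation : Series → Slices → Set ℓ
  SliceEquation Λ V = V 𝕊.≈ (tSlice 𝕊.+ Φ Λ (V ^_))

data Position (q : ℕ) : ℕ → Set where
  before : ∀ {n} → n ≤ q → Position q n
  at     : Position q (suc q)
  after  : ∀ m → Position q (2 +ℕ q +ℕ m)

position : ∀ q n → Position q n
position q       zero          = before z≤n
position zero    (suc zero)    = at
position zero    (suc (suc m)) = after m
position (suc q) (suc n) with position q n
... | before n≤q = before (s≤s n≤q)
... | at         = at
... | after m    = after m

module _ {c ℓ} (K : CommutativeRing c ℓ) where
  open CommutativeRing K
  open PowerSeries K

  module DiagonalsOfSolution (Λ : Series) (Λ₀≈0 : Λ 0 ≈ 0#) (Λ₁≈0 : Λ 1 ≈ 0#) where
    open FiniteSums K
    open Solution K Λ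
    open SolutionSupport K Λ Λ₀≈0 Λ₁≈0
    open Support K
    open DiagonalProduct K
    open Slices K
    open import Relation.Binary.Reasoning.Setoid setoid

    W : Slices
    W q = diagonal H (suc q)

    diagonal-one₂ : ∀ s n → diagonal one₂ s n ≈ 𝕊.1# s n
    diagonal-one₂ zero    zero    = refl
    diagonal-one₂ zero    (suc n) = refl
    diagonal-one₂ (suc s) n with suc s ≤? n
    diagonal-one₂ (suc s) (suc n) | yes _ = refl
    ... | no _ = refl

    diagonal-pow₂ : ∀ j s n → diagonal (pow₂ H j) (j +ℕ s) n ≈ (W ^ j) s n
    diagonal-pow₂ zero    s n = diagonal-one₂ s n
    diagonal-pow₂ (suc j) s n = begin
      diagonal (H *₂ pow₂ H j) (1 +ℕ j +ℕ s) n
        ≈⟨ diagonal-*₂ 1 j H-support (pow₂-support H-support j) s n ⟩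
      sumTo s (λ r → (W r *ₛ diagonal (pow₂ H j) (j +ℕ (s ∸ r))) n)
        ≈⟨ sumTo-cong s (λ r → sumTo-cong n (λ i → *-congˡ (diagonal-pow₂ j (s ∸ r) (n ∸ i)))) ⟩
      sumTo s (λ r → (W r *ₛ (W ^ j) (s ∸ r)) n)
        ≈⟨ ℙ-sumTo-at s (λ r → W r *ₛ (W ^ j) (s ∸ r)) n ⟨
      (W ^ suc j) s n ∎

    Φ-diagonal : ∀ q n → Φ Λ (W ^_) q n ≈ sumTo q (λ j → Λ (2 +ℕ j) * diagonal (pow₂ H (2 +ℕ j)) (2 +ℕ q) n)
    Φ-diagonal q n = sumTo-cong≤ q (λ j j≤q → *-congˡ (begin
      (W ^ (2 +ℕ j)) (q ∸ j) n                       ≈⟨ diagonal-pow₂ (2 +ℕ j) (q ∸ j) n ⟨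
      diagonal (pow₂ H (2 +ℕ j)) (2 +ℕ j +ℕ (q ∸ j)) n
        ≡⟨ ≡.cong (λ z → diagonal (pow₂ H (2 +ℕ j)) (2 +ℕ z) n) (ℕP.m+[n∸m]≡n j≤q) ⟩
      diagonal (pow₂ H (2 +ℕ j)) (2 +ℕ q) n           ∎))

    Φ-below : ∀ q n → ¬ (2 +ℕ q ≤ n) → Φ Λ (W ^_) q n ≈ 0#
    Φ-below q n 2+q≰n = trans (Φ-diagonal q n)
      (sumTo-zero q (λ j _ → trans (*-congˡ (diagonal-≰ (pow₂ H (2 +ℕ j)) _ n 2+q≰n)) (zeroʳ _)))

    -- Only Λ₂, …, Λ_{q+2} reach the coefficient of t^(m+2+q) k^m in Λ(H).
    compose-diagonal : ∀ q m → compose Λ H (2 +ℕ q +ℕ m) m ≈ Φ Λ (W ^_) q (2 +ℕ q +ℕ m)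
    compose-diagonal q m = begin
      sumTo (n +ℕ m) f                          ≈⟨ sumTo-extend (2 +ℕ q) (n +ℕ m) 2+q≤n+m vanishing ⟩
      sumTo (2 +ℕ q) f                          ≈⟨ sumTo-sucˡ (suc q) f ⟩
      f 0 + sumTo (suc q) (f ∘ suc)             ≈⟨ +-cong (killed Λ₀≈0) (sumTo-sucˡ q (f ∘ suc)) ⟩
      0# + (f 1 + sumTo q (λ j → f (2 +ℕ j)))   ≈⟨ +-identityˡ _ ⟩
      f 1 + sumTo q (λ j → f (2 +ℕ j))          ≈⟨ +-congʳ (killed Λ₁≈0) ⟩
      0# + sumTo q (λ j → f (2 +ℕ j))           ≈⟨ +-identityˡ _ ⟩
      sumTo q (λ j → f (2 +ℕ j))                ≈⟨ sumTo-cong q (λ j → *-congˡ (on-diagonal j)) ⟨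
      sumTo q (λ j → Λ (2 +ℕ j) * diagonal (pow₂ H (2 +ℕ j)) (2 +ℕ q) n)
                                                ≈⟨ Φ-diagonal q n ⟨
      Φ Λ (W ^_) q n                            ∎
      where
      n = 2 +ℕ q +ℕ m
      f : ℕ → Carrier
      f j = Λ j * pow₂ H j n m
      killed : ∀ {j} → Λ j ≈ 0# → f j ≈ 0#
      killed Λⱼ≈0 = trans (*-congʳ Λⱼ≈0) (zeroˡ _)
      2+q≤n : 2 +ℕ q ≤ n
      2+q≤n = ℕP.m≤m+n (2 +ℕ q) m
      2+q≤n+m : 2 +ℕ q ≤ n +ℕ m
      2+q≤n+m = ℕP.≤-trans 2+q≤n (ℕP.m≤m+n n m)
      on-diagonal : ∀ j → diagonal (pow₂ H (2 +ℕ j)) (2 +ℕ q) n ≈ pow₂ H (2 +ℕ j) n m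
      on-diagonal j = trans (diagonal-≤ (pow₂ H (2 +ℕ j)) (2 +ℕ q) n 2+q≤n)
        (reflexive (≡.cong (pow₂ H (2 +ℕ j) n) (ℕP.m+n∸m≡n (2 +ℕ q) m)))
      vanishing : ∀ j → 2 +ℕ q < j → j ≤ n +ℕ m → f j ≈ 0#
      vanishing j 2+q<j _ = trans (*-congˡ (pow₂-support H-support j n m
        (≡.subst (n <_) (ℕP.+-comm j m) (ℕP.+-monoˡ-< m 2+q<j)))) (zeroʳ _)

    tSlice-before : ∀ q n → n ≤ q → tSlice q n ≈ 0#
    tSlice-before zero    zero z≤n = refl
    tSlice-before (suc q) n    _   = refl

    tSlice-after : ∀ q m → tSlice q (2 +ℕ q +ℕ m) ≈ 0#
    tSlice-after zero    m = refl
    tSlice-after (suc q) m = refl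

    rhs-column-zero : ∀ q → rhs Λ H (suc q) 0 ≈ tSlice q (suc q)
    rhs-column-zero zero    = refl
    rhs-column-zero (suc q) = refl

    W-slice-before : ∀ q n → n ≤ q → W q n ≈ tSlice q n + Φ Λ (W ^_) q n
    W-slice-before q n n≤q = begin
      W q n                          ≈⟨ diagonal-≰ H (suc q) n (λ 1+q≤n → ℕP.<-irrefl ≡.refl (ℕP.≤-trans 1+q≤n n≤q)) ⟩
      0#                             ≈⟨ +-identityʳ 0# ⟨
      0# + 0#                        ≈⟨ +-cong (tSlice-before q n n≤q) (Φ-below q n 2+q≰n) ⟨
      tSlice q n + Φ Λ (W ^_) q n    ∎
      where
      2+q≰n : ¬ (2 +ℕ q ≤ n)
      2+q≰n 2+q≤n = ℕP.<-irrefl ≡.refl (ℕP.≤-trans 2+q≤n (ℕP.≤-trans n≤q (ℕP.n≤1+n q)))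

    W-slice-at : ∀ q → W q (suc q) ≈ tSlice q (suc q) + Φ Λ (W ^_) q (suc q)
    W-slice-at q = begin
      W q (suc q)                                  ≈⟨ diagonal-≤ H (suc q) (suc q) ℕP.≤-refl ⟩
      H (suc q) (q ∸ q)                            ≡⟨ ≡.cong (H (suc q)) (ℕP.n∸n≡0 q) ⟩
      H (suc q) 0                                  ≈⟨ proj₂ H-solution (suc q) 0 ⟩
      rhs Λ H (suc q) 0                            ≈⟨ rhs-column-zero q ⟩
      tSlice q (suc q)                             ≈⟨ +-identityʳ _ ⟨
      tSlice q (suc q) + 0#                        ≈⟨ +-congˡ (Φ-below q (suc q) (ℕP.<-irrefl ≡.refl)) ⟨
      tSlice q (suc q) + Φ Λ (W ^_) q (suc q)      ∎

    W-slice-after : ∀ q m → let n = 2 +ℕ q +ℕ m in W q n ≈ tSlice q n + Φ Λ (W ^_) q n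
    W-slice-after q m = begin
      W q n                          ≈⟨ diagonal-≤ H (suc q) n (ℕP.≤-trans (ℕP.n≤1+n (suc q)) (ℕP.m≤m+n (2 +ℕ q) m)) ⟩
      H n (n ∸ suc q)                ≡⟨ ≡.cong (H n) n∸[1+q]≡1+m ⟩
      H n (suc m)                    ≈⟨ proj₂ H-solution n (suc m) ⟩
      rhs Λ H n (suc m)              ≈⟨ rhs-suc H n m ⟩
      compose Λ H n m                ≈⟨ compose-diagonal q m ⟩
      Φ Λ (W ^_) q n                 ≈⟨ +-identityˡ _ ⟨
      0# + Φ Λ (W ^_) q n            ≈⟨ +-congʳ (tSlice-after q m) ⟨
      tSlice q n + Φ Λ (W ^_) q n    ∎
      where
      n = 2 +ℕ q +ℕ m
      n∸[1+q]≡1+m : n ∸ suc q ≡ suc m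
      n∸[1+q]≡1+m = ≡.trans (≡.cong (_∸ q) (≡.sym (ℕP.+-suc q m))) (ℕP.m+n∸m≡n q (suc m))

    W-slice-equation : SliceEquation Λ W
    W-slice-equation q n with position q n
    ... | before n≤q = W-slice-before q n n≤q
    ... | at         = W-slice-at q
    ... | after m    = W-slice-after q m

    W₀₀≈0 : W 0 0 ≈ 0#
    W₀₀≈0 = diagonal-≰ H 1 0 (λ ())

    W₀-catalan : ∀ n → W 0 n ≈ tₛ n + Λ 2 * (W 0 *ₛ W 0) n
    W₀-catalan n = trans (W-slice-equation 0 n) (+-congˡ (*-congˡ (Ps.*-congˡ {W 0} (Ps.*-identityʳ (W 0)) n)))
      where module Ps = CommutativeRing (SeriesRing.seriesRing K)

    diagonal-zero : ∀ n → diagonal H 0 n ≈ 0#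
    diagonal-zero n = trans (diagonal-≤ H 0 n z≤n) (H-support n n (ℕP.≤-reflexive (ℕP.+-comm 1 n)))

module _ {c ℓ} (K : CommutativeRing c ℓ) where
  open CommutativeRing K
  open PowerSeries K

  module CatalanCoefficients (λ₂ : Carrier) (h : Series) (h₀≈0 : h 0 ≈ 0#)
    (catalan : ∀ n → h n ≈ tₛ n + λ₂ * (h *ₛ h) n) where
    open FiniteSums K
    open import Algebra.Properties.Semiring.Exp semiring using (_^_; ^-homo-*)
    open import Algebra.Properties.Semiring.Mult semiring using (×1-homo-*)
    open import Algebra.Properties.Monoid.Mult +-monoid using (×-homo-+; ×-homo-1)
    open import Algebra.Properties.CommutativeSemigroup *-commutativeSemigroup using (interchange)
    open import Relation.Binary.Reasoning.Setoid setoid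

    -- hₙ₊₁ is λ₂ⁿ times the n-th Catalan number.
    record PositiveMultiple (k : ℕ) (z : Carrier) : Set ℓ where
      constructor positive
      field
        coefficient : ℕ
        1≤coefficient : 1 ≤ coefficient
        equation : z ≈ λ₂ ^ k * (coefficient ·ℕ 1#)

    positive-cong : ∀ {k x y} → x ≈ y → PositiveMultiple k x → PositiveMultiple k y
    positive-cong x≈y (positive c 1≤c eq) = positive c 1≤c (trans (sym x≈y) eq)

    positive-+ : ∀ {k x y} → PositiveMultiple k x → PositiveMultiple k y → PositiveMultiple k (x + y)
    positive-+ (positive c 1≤c x≈) (positive d _ y≈) = positive (c +ℕ d) (ℕP.≤-trans 1≤c (ℕP.m≤m+n c d))
      (trans (+-cong x≈ y≈) (trans (sym (distribˡ _ _ _)) (*-congˡ (sym (×-homo-+ 1# c d)))))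

    positive-* : ∀ {a b x y} → PositiveMultiple a x → PositiveMultiple b y → PositiveMultiple (a +ℕ b) (x * y)
    positive-* {a} {b} (positive c 1≤c x≈) (positive d 1≤d y≈) = positive (c *ℕ d) (ℕP.*-mono-≤ 1≤c 1≤d) (begin
      _                                             ≈⟨ *-cong x≈ y≈ ⟩
      (λ₂ ^ a * (c ·ℕ 1#)) * (λ₂ ^ b * (d ·ℕ 1#))   ≈⟨ interchange _ _ _ _ ⟩
      (λ₂ ^ a * λ₂ ^ b) * ((c ·ℕ 1#) * (d ·ℕ 1#))   ≈⟨ *-cong (^-homo-* λ₂ a b) (×1-homo-* c d) ⟨
      λ₂ ^ (a +ℕ b) * ((c *ℕ d) ·ℕ 1#)              ∎)

    positive-sumTo : ∀ {k} n f → (∀ i → i ≤ n → PositiveMultiple k (f i)) → PositiveMultiple k (sumTo n f)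
    positive-sumTo zero    f pos = pos 0 z≤n
    positive-sumTo (suc n) f pos =
      positive-+ (positive-sumTo n f (λ i i≤n → pos i (ℕP.m≤n⇒m≤1+n i≤n))) (pos (suc n) ℕP.≤-refl)

    positive-λ₂* : ∀ {k x} → PositiveMultiple k x → PositiveMultiple (suc k) (λ₂ * x)
    positive-λ₂* (positive c 1≤c x≈) = positive c 1≤c (trans (*-congˡ x≈) (sym (*-assoc _ _ _)))

    h₁ : PositiveMultiple 0 (h 1)
    h₁ = positive 1 ℕP.≤-refl (begin
      h 1                                         ≈⟨ catalan 1 ⟩
      1# + λ₂ * (h 0 * h 1 + h 1 * h 0)            ≈⟨ +-congˡ (*-congˡ (+-cong (trans (*-congʳ h₀≈0) (zeroˡ _))
                                                                              (trans (*-congˡ h₀≈0) (zeroʳ _)))) ⟩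
      1# + λ₂ * (0# + 0#)                         ≈⟨ +-congˡ (trans (*-congˡ (+-identityˡ _)) (zeroʳ _)) ⟩
      1# + 0#                                     ≈⟨ +-identityʳ _ ⟩
      1#                                          ≈⟨ trans (*-identityˡ _) (×-homo-1 1#) ⟨
      λ₂ ^ 0 * (1 ·ℕ 1#)                          ∎)

    h-recurrence : ∀ k → h (2 +ℕ k) ≈ λ₂ * sumTo k (λ i → h (suc i) * h (suc k ∸ i))
    h-recurrence k = begin
      h (2 +ℕ k)                                               ≈⟨ catalan (2 +ℕ k) ⟩
      0# + λ₂ * sumTo (2 +ℕ k) f                               ≈⟨ +-identityˡ _ ⟩
      λ₂ * sumTo (2 +ℕ k) f                                    ≈⟨ *-congˡ (sumTo-sucˡ (suc k) f) ⟩
      λ₂ * (f 0 + (sumTo k (f ∘ suc) + f (2 +ℕ k)))            ≈⟨ *-congˡ (+-cong f₀≈0 (+-congˡ f-last≈0)) ⟩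
      λ₂ * (0# + (sumTo k (f ∘ suc) + 0#))                     ≈⟨ *-congˡ (trans (+-identityˡ _) (+-identityʳ _)) ⟩
      λ₂ * sumTo k (f ∘ suc)                                   ∎
      where
      f : ℕ → Carrier
      f i = h i * h (2 +ℕ k ∸ i)
      f₀≈0 : f 0 ≈ 0#
      f₀≈0 = trans (*-congʳ h₀≈0) (zeroˡ _)
      f-last≈0 : f (2 +ℕ k) ≈ 0#
      f-last≈0 = trans (*-congˡ (trans (reflexive (≡.cong h (ℕP.n∸n≡0 k))) h₀≈0)) (zeroʳ _)

    h-positive : ∀ n → PositiveMultiple n (h (suc n))
    h-positive = <-rec _ step
      where
      step : ∀ n → (∀ {i} → i < n → PositiveMultiple i (h (suc i))) → PositiveMultiple n (h (suc n))
      step zero    _     = h₁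
      step (suc k) below = positive-cong (sym (h-recurrence k)) (positive-λ₂* (positive-sumTo k _ term))
        where
        term : ∀ i → i ≤ k → PositiveMultiple k (h (suc i) * h (suc k ∸ i))
        term i i≤k = ≡.subst (λ e → PositiveMultiple e (h (suc i) * h (suc k ∸ i))) (ℕP.m+[n∸m]≡n i≤k)
          (positive-cong (*-congˡ (reflexive (≡.cong h (≡.sym (ℕP.+-∸-assoc 1 i≤k)))))
            (positive-* (below (s≤s i≤k)) (below (s≤s (ℕP.m∸n≤m k i)))))

    h-nonzero : IsField → CharZero → ¬ (λ₂ ≈ 0#) → ∀ n → ¬ (h (suc n) ≈ 0#)
    h-nonzero isField char0 λ₂≉0 n hₙ₊₁≈0 with h-positive n
    ... | positive c 1≤c eq = ℕP.<⇒≢ 1≤c (≡.sym (char0 c (*-cancelˡ-≈0 (λ₂^n≉0 n) (trans (sym eq) hₙ₊₁≈0))))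
      where
      open FieldLemmas K isField
      λ₂^n≉0 : ∀ n → ¬ (λ₂ ^ n ≈ 0#)
      λ₂^n≉0 zero    = 1≉0
      λ₂^n≉0 (suc n) = *-≉0 λ₂≉0 (λ₂^n≉0 n)

module _ {c ℓ} (K : CommutativeRing c ℓ) where
  open CommutativeRing K
  open PowerSeries K

  module ParityClasses (S Sinv : Series) (S*Sinv≈1 : (S *ₛ Sinv) ≈ₛ oneₛ) where
    open SeriesAlgebra K
    open import Relation.Binary.Reasoning.Setoid Ps.setoid

    S² S⁻² : Series
    S² = S *ₛ S
    S⁻² = Sinv *ₛ Sinv

    S⁻²*S²≈1 : (S⁻² *ₛ S²) ≈ₛ oneₛ
    S⁻²*S²≈1 = Ps.trans
      (solveₛ 2 (λ s s⁻¹ → (s⁻¹ :*ₛ s⁻¹) :*ₛ (s :*ₛ s) :=ₛ (s :*ₛ s⁻¹) :*ₛ (s :*ₛ s⁻¹)) Ps.refl S Sinv)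
                        (Ps.trans (Ps.*-cong S*Sinv≈1 S*Sinv≈1) (Ps.*-identityˡ oneₛ))

    Sinv*S²≈S : (Sinv *ₛ S²) ≈ₛ S
    Sinv*S²≈S = Ps.trans (solveₛ 2 (λ s s⁻¹ → s⁻¹ :*ₛ (s :*ₛ s) :=ₛ s :*ₛ (s :*ₛ s⁻¹)) Ps.refl S Sinv)
                         (Ps.trans (Ps.*-congˡ {S} S*Sinv≈1) (Ps.*-identityʳ S))

    record EvenPoly (f : Series) : Set (c ⊔ ℓ) where
      constructor evenPoly
      field
        coefficients : List Carrier
        equation : f ≈ₛ polyₛ coefficients S²

    record EvenLaurent (f : Series) : Set (c ⊔ ℓ) where
      constructor evenLaurent
      field
        order : ℕ
        coefficients : List Carrier
        equation : f ≈ₛ ((S⁻² ^ₛ order) *ₛ polyₛ coefficients S²)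

    record OddLaurent (f : Series) : Set (c ⊔ ℓ) where
      constructor oddLaurent
      field
        order : ℕ
        coefficients : List Carrier
        equation : f ≈ₛ (Sinv *ₛ ((S⁻² ^ₛ order) *ₛ polyₛ coefficients S²))

    evenPoly-cong : ∀ {f g} → f ≈ₛ g → EvenPoly f → EvenPoly g
    evenPoly-cong f≈g (evenPoly p eq) = evenPoly p (Ps.trans (Ps.sym f≈g) eq)

    evenPoly-0 : EvenPoly zeroₛ
    evenPoly-0 = evenPoly [] Ps.refl

    evenPoly-1 : EvenPoly oneₛ
    evenPoly-1 = evenPoly (1# ∷ []) (Ps.sym (Ps.trans (polyₛ-single 1# S²) constₛ-1))

    evenPoly-+ : ∀ {f g} → EvenPoly f → EvenPoly g → EvenPoly (f +ₛ g)
    evenPoly-+ (evenPoly p eq) (evenPoly q eq′) =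
      evenPoly (addPoly p q) (Ps.trans (Ps.+-cong eq eq′) (Ps.sym (polyₛ-addPoly p q S²)))

    evenPoly-* : ∀ {f g} → EvenPoly f → EvenPoly g → EvenPoly (f *ₛ g)
    evenPoly-* (evenPoly p eq) (evenPoly q eq′) =
      evenPoly (mulPoly p q) (Ps.trans (Ps.*-cong eq eq′) (Ps.sym (polyₛ-mulPoly p q S²)))

    evenPoly-· : ∀ a {f} → EvenPoly f → EvenPoly (a ·ₛ f)
    evenPoly-· a {f} (evenPoly p eq) = evenPoly (scalePoly a p)
      (Ps.trans (·ₛ≈constₛ-*ₛ a f) (Ps.trans (Ps.*-congˡ {constₛ a} eq) (Ps.sym (polyₛ-scalePoly a p S²))))

    evenPoly-sub : ∀ {f g} → EvenPoly f → EvenPoly g → EvenPoly (f Ps.- g)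
    evenPoly-sub {g = g} f-even g-even = evenPoly-+ f-even (evenPoly-cong (Ps.sym (-ₛ≈-1·ₛ g)) (evenPoly-· (- 1#) g-even))

    evenPoly-sumTo : ∀ n (F : ℕ → Series) → (∀ i → i ≤ n → EvenPoly (F i)) →
      EvenPoly (PowerSeries.sumTo (SeriesRing.seriesRing K) n F)
    evenPoly-sumTo zero    F even = even 0 z≤n
    evenPoly-sumTo (suc n) F even =
      evenPoly-+ (evenPoly-sumTo n F (λ i i≤n → even i (ℕP.m≤n⇒m≤1+n i≤n))) (even (suc n) ℕP.≤-refl)

    -- Multiplying by (S⁻²)ᴹ (S²)ᴹ = 1 brings two even Laurent polynomials to a common order.
    raise-order : ∀ N M P → ((S⁻² ^ₛ N) *ₛ P) ≈ₛ ((S⁻² ^ₛ (N +ℕ M)) *ₛ ((S² ^ₛ M) *ₛ P))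
    raise-order N M P = Ps.sym (begin
      (S⁻² ^ₛ (N +ℕ M)) *ₛ ((S² ^ₛ M) *ₛ P)
        ≈⟨ Ps.*-congʳ {(S² ^ₛ M) *ₛ P} (^ₛ-+ S⁻² N M) ⟩
      ((S⁻² ^ₛ N) *ₛ (S⁻² ^ₛ M)) *ₛ ((S² ^ₛ M) *ₛ P)
        ≈⟨ solveₛ 4 (λ a b c p → (a :*ₛ b) :*ₛ (c :*ₛ p) :=ₛ a :*ₛ ((b :*ₛ c) :*ₛ p))
             Ps.refl (S⁻² ^ₛ N) (S⁻² ^ₛ M) (S² ^ₛ M) P ⟩
      (S⁻² ^ₛ N) *ₛ (((S⁻² ^ₛ M) *ₛ (S² ^ₛ M)) *ₛ P)
        ≈⟨ Ps.*-congˡ {S⁻² ^ₛ N} (Ps.*-congʳ {P} (Ps.trans (Ps.sym (^ₛ-*ₛ S⁻² S² M)) (^ₛ-oneₛ M S⁻²*S²≈1))) ⟩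
      (S⁻² ^ₛ N) *ₛ (oneₛ *ₛ P)
        ≈⟨ Ps.*-congˡ {S⁻² ^ₛ N} (Ps.*-identityˡ P) ⟩
      (S⁻² ^ₛ N) *ₛ P ∎)

    evenLaurent-cong : ∀ {f g} → f ≈ₛ g → EvenLaurent f → EvenLaurent g
    evenLaurent-cong f≈g (evenLaurent N p eq) = evenLaurent N p (Ps.trans (Ps.sym f≈g) eq)

    evenPoly⇒evenLaurent : ∀ {f} → EvenPoly f → EvenLaurent f
    evenPoly⇒evenLaurent (evenPoly p eq) = evenLaurent 0 p (Ps.trans eq (Ps.sym (Ps.*-identityˡ (polyₛ p S²))))

    evenLaurent-+ : ∀ {f g} → EvenLaurent f → EvenLaurent g → EvenLaurent (f +ₛ g)
    evenLaurent-+ (evenLaurent N p eq) (evenLaurent M q eq′) =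
      evenLaurent (N +ℕ M) (addPoly (shiftPoly M p) (shiftPoly N q)) (begin
      _ ≈⟨ Ps.+-cong eq eq′ ⟩
      ((S⁻² ^ₛ N) *ₛ polyₛ p S²) +ₛ ((S⁻² ^ₛ M) *ₛ polyₛ q S²)
        ≈⟨ Ps.+-cong (raise-order N M (polyₛ p S²))
             (≡.subst (λ z → ((S⁻² ^ₛ M) *ₛ polyₛ q S²) ≈ₛ ((S⁻² ^ₛ z) *ₛ ((S² ^ₛ N) *ₛ polyₛ q S²)))
                      (ℕP.+-comm M N) (raise-order M N (polyₛ q S²))) ⟩
      ((S⁻² ^ₛ (N +ℕ M)) *ₛ ((S² ^ₛ M) *ₛ polyₛ p S²)) +ₛ ((S⁻² ^ₛ (N +ℕ M)) *ₛ ((S² ^ₛ N) *ₛ polyₛ q S²))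
        ≈⟨ Ps.sym (Ps.distribˡ (S⁻² ^ₛ (N +ℕ M)) ((S² ^ₛ M) *ₛ polyₛ p S²) ((S² ^ₛ N) *ₛ polyₛ q S²)) ⟩
      (S⁻² ^ₛ (N +ℕ M)) *ₛ (((S² ^ₛ M) *ₛ polyₛ p S²) +ₛ ((S² ^ₛ N) *ₛ polyₛ q S²))
        ≈⟨ Ps.*-congˡ {S⁻² ^ₛ (N +ℕ M)} (Ps.sym (Ps.trans (polyₛ-addPoly (shiftPoly M p) (shiftPoly N q) S²)
             (Ps.+-cong (polyₛ-shiftPoly M p S²) (polyₛ-shiftPoly N q S²)))) ⟩
      (S⁻² ^ₛ (N +ℕ M)) *ₛ polyₛ (addPoly (shiftPoly M p) (shiftPoly N q)) S² ∎)

    evenLaurent-· : ∀ a {f} → EvenLaurent f → EvenLaurent (a ·ₛ f)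
    evenLaurent-· a {f} (evenLaurent N p eq) = evenLaurent N (scalePoly a p) (begin
      a ·ₛ f                                    ≈⟨ ·ₛ≈constₛ-*ₛ a f ⟩
      constₛ a *ₛ f                             ≈⟨ Ps.*-congˡ {constₛ a} eq ⟩
      constₛ a *ₛ ((S⁻² ^ₛ N) *ₛ polyₛ p S²)    ≈⟨ solveₛ 3 (λ x y z → x :*ₛ (y :*ₛ z) :=ₛ y :*ₛ (x :*ₛ z))
                                                     Ps.refl (constₛ a) (S⁻² ^ₛ N) (polyₛ p S²) ⟩
      (S⁻² ^ₛ N) *ₛ (constₛ a *ₛ polyₛ p S²)    ≈⟨ Ps.*-congˡ {S⁻² ^ₛ N} (Ps.sym (polyₛ-scalePoly a p S²)) ⟩
      (S⁻² ^ₛ N) *ₛ polyₛ (scalePoly a p) S²    ∎)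

    evenLaurent-sub : ∀ {f g} → EvenLaurent f → EvenLaurent g → EvenLaurent (f Ps.- g)
    evenLaurent-sub {g = g} f-even g-even =
      evenLaurent-+ f-even (evenLaurent-cong (Ps.sym (-ₛ≈-1·ₛ g)) (evenLaurent-· (- 1#) g-even))

    evenLaurent-sumTo : ∀ n (F : ℕ → Series) → (∀ i → i ≤ n → EvenLaurent (F i)) →
      EvenLaurent (PowerSeries.sumTo (SeriesRing.seriesRing K) n F)
    evenLaurent-sumTo zero    F even = even 0 z≤n
    evenLaurent-sumTo (suc n) F even =
      evenLaurent-+ (evenLaurent-sumTo n F (λ i i≤n → even i (ℕP.m≤n⇒m≤1+n i≤n))) (even (suc n) ℕP.≤-refl)

    oddLaurent-cong : ∀ {f g} → f ≈ₛ g → OddLaurent f → OddLaurent g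
    oddLaurent-cong f≈g (oddLaurent N p eq) = oddLaurent N p (Ps.trans (Ps.sym f≈g) eq)

    Sinv*evenLaurent : ∀ {f} → EvenLaurent f → OddLaurent (Sinv *ₛ f)
    Sinv*evenLaurent (evenLaurent N p eq) = oddLaurent N p (Ps.*-congˡ {Sinv} eq)

    oddLaurent-· : ∀ a {f} → OddLaurent f → OddLaurent (a ·ₛ f)
    oddLaurent-· a {f} (oddLaurent N p eq) = oddLaurent N (scalePoly a p) (begin
      a ·ₛ f                                                ≈⟨ ·ₛ≈constₛ-*ₛ a f ⟩
      constₛ a *ₛ f                                         ≈⟨ Ps.*-congˡ {constₛ a} eq ⟩
      constₛ a *ₛ (Sinv *ₛ ((S⁻² ^ₛ N) *ₛ polyₛ p S²))
        ≈⟨ solveₛ 4 (λ x s y z → x :*ₛ (s :*ₛ (y :*ₛ z)) :=ₛ s :*ₛ (y :*ₛ (x :*ₛ z)))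
             Ps.refl (constₛ a) Sinv (S⁻² ^ₛ N) (polyₛ p S²) ⟩
      Sinv *ₛ ((S⁻² ^ₛ N) *ₛ (constₛ a *ₛ polyₛ p S²))
        ≈⟨ Ps.*-congˡ {Sinv} (Ps.*-congˡ {S⁻² ^ₛ N} (Ps.sym (polyₛ-scalePoly a p S²))) ⟩
      Sinv *ₛ ((S⁻² ^ₛ N) *ₛ polyₛ (scalePoly a p) S²)      ∎)

    oddLaurent-* : ∀ {f g} → OddLaurent f → OddLaurent g → EvenLaurent (f *ₛ g)
    oddLaurent-* {f} {g} (oddLaurent N p eq) (oddLaurent M q eq′) = evenLaurent (suc (N +ℕ M)) (mulPoly p q) (begin
      f *ₛ g
        ≈⟨ Ps.*-cong eq eq′ ⟩
      (Sinv *ₛ ((S⁻² ^ₛ N) *ₛ polyₛ p S²)) *ₛ (Sinv *ₛ ((S⁻² ^ₛ M) *ₛ polyₛ q S²))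
        ≈⟨ solveₛ 5 (λ s a b x y → (s :*ₛ (a :*ₛ x)) :*ₛ (s :*ₛ (b :*ₛ y)) :=ₛ ((s :*ₛ s) :*ₛ (a :*ₛ b)) :*ₛ (x :*ₛ y))
             Ps.refl Sinv (S⁻² ^ₛ N) (S⁻² ^ₛ M) (polyₛ p S²) (polyₛ q S²) ⟩
      (S⁻² *ₛ ((S⁻² ^ₛ N) *ₛ (S⁻² ^ₛ M))) *ₛ (polyₛ p S² *ₛ polyₛ q S²)
        ≈⟨ Ps.*-cong (Ps.*-congˡ {S⁻²} (Ps.sym (^ₛ-+ S⁻² N M))) (Ps.sym (polyₛ-mulPoly p q S²)) ⟩
      (S⁻² ^ₛ suc (N +ℕ M)) *ₛ polyₛ (mulPoly p q) S² ∎)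

    oddLaurent-S : ∀ b → OddLaurent (b ·ₛ S)
    oddLaurent-S b = oddLaurent 0 (0# ∷ b ∷ []) (Ps.sym (begin
      Sinv *ₛ (oneₛ *ₛ polyₛ (0# ∷ b ∷ []) S²)
        ≈⟨ Ps.*-congˡ {Sinv} (Ps.trans (Ps.*-identityˡ _)
             (Ps.trans (polyₛ-cons0 (b ∷ []) S²) (Ps.*-congˡ {S²} (polyₛ-single b S²)))) ⟩
      Sinv *ₛ (S² *ₛ constₛ b)    ≈⟨ Ps.sym (Ps.*-assoc Sinv S² (constₛ b)) ⟩
      (Sinv *ₛ S²) *ₛ constₛ b    ≈⟨ Ps.*-congʳ {constₛ b} Sinv*S²≈S ⟩
      S *ₛ constₛ b               ≈⟨ Ps.*-comm S (constₛ b) ⟩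
      constₛ b *ₛ S               ≈⟨ Ps.sym (·ₛ≈constₛ-*ₛ b S) ⟩
      b ·ₛ S                      ∎))

    NoEvenNeg : Series → Set (c ⊔ ℓ)
    NoEvenNeg = LaurentNoEvenNeg S Sinv

    noEvenNeg-cong : ∀ {f g} → f ≈ₛ g → NoEvenNeg f → NoEvenNeg g
    noEvenNeg-cong f≈g (p , q , eq) = p , q , Ps.trans (Ps.sym f≈g) eq

    noEvenNeg-+ : ∀ {f g} → NoEvenNeg f → NoEvenNeg g → NoEvenNeg (f +ₛ g)
    noEvenNeg-+ {f} {g} (p , q , eq) (p′ , q′ , eq′) = addPoly p p′ , addPoly q q′ , (begin
      f +ₛ g
        ≈⟨ Ps.+-cong eq eq′ ⟩
      (polyₛ p S +ₛ (Sinv *ₛ polyₛ q S⁻²)) +ₛ (polyₛ p′ S +ₛ (Sinv *ₛ polyₛ q′ S⁻²))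
        ≈⟨ solveₛ 5 (λ a b s x y → (a :+ₛ (s :*ₛ x)) :+ₛ (b :+ₛ (s :*ₛ y)) :=ₛ (a :+ₛ b) :+ₛ (s :*ₛ (x :+ₛ y)))
             Ps.refl (polyₛ p S) (polyₛ p′ S) Sinv (polyₛ q S⁻²) (polyₛ q′ S⁻²) ⟩
      (polyₛ p S +ₛ polyₛ p′ S) +ₛ (Sinv *ₛ (polyₛ q S⁻² +ₛ polyₛ q′ S⁻²))
        ≈⟨ Ps.sym (Ps.+-cong (polyₛ-addPoly p p′ S) (Ps.*-congˡ {Sinv} (polyₛ-addPoly q q′ S⁻²))) ⟩
      polyₛ (addPoly p p′) S +ₛ (Sinv *ₛ polyₛ (addPoly q q′) S⁻²) ∎)

    noEvenNeg-· : ∀ a {f} → NoEvenNeg f → NoEvenNeg (a ·ₛ f)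
    noEvenNeg-· a {f} (p , q , eq) = scalePoly a p , scalePoly a q , (begin
      a ·ₛ f
        ≈⟨ ·ₛ≈constₛ-*ₛ a f ⟩
      constₛ a *ₛ f
        ≈⟨ Ps.*-congˡ {constₛ a} eq ⟩
      constₛ a *ₛ (polyₛ p S +ₛ (Sinv *ₛ polyₛ q S⁻²))
        ≈⟨ solveₛ 4 (λ e x s y → e :*ₛ (x :+ₛ (s :*ₛ y)) :=ₛ (e :*ₛ x) :+ₛ (s :*ₛ (e :*ₛ y)))
             Ps.refl (constₛ a) (polyₛ p S) Sinv (polyₛ q S⁻²) ⟩
      (constₛ a *ₛ polyₛ p S) +ₛ (Sinv *ₛ (constₛ a *ₛ polyₛ q S⁻²))
        ≈⟨ Ps.sym (Ps.+-cong (polyₛ-scalePoly a p S) (Ps.*-congˡ {Sinv} (polyₛ-scalePoly a q S⁻²))) ⟩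
      polyₛ (scalePoly a p) S +ₛ (Sinv *ₛ polyₛ (scalePoly a q) S⁻²) ∎)

    noEvenNeg-poly : ∀ p → NoEvenNeg (polyₛ p S)
    noEvenNeg-poly p = p , [] , Ps.sym (Ps.trans (Ps.+-congˡ {polyₛ p S} (Ps.zeroʳ Sinv)) (Ps.+-identityʳ (polyₛ p S)))

    evenPoly⇒noEvenNeg : ∀ {f} → EvenPoly f → NoEvenNeg f
    evenPoly⇒noEvenNeg (evenPoly p eq) =
      noEvenNeg-cong (Ps.trans (polyₛ-spreadPoly p S) (Ps.sym eq)) (noEvenNeg-poly (spreadPoly p))

    noEvenNeg-Sinv*S⁻² : ∀ N a → NoEvenNeg (a ·ₛ (Sinv *ₛ (S⁻² ^ₛ N)))
    noEvenNeg-Sinv*S⁻² N a = [] , shiftPoly N (a ∷ []) , Ps.sym (begin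
      zeroₛ +ₛ (Sinv *ₛ polyₛ (shiftPoly N (a ∷ [])) S⁻²)
        ≈⟨ Ps.+-identityˡ _ ⟩
      Sinv *ₛ polyₛ (shiftPoly N (a ∷ [])) S⁻²
        ≈⟨ Ps.*-congˡ {Sinv} (Ps.trans (polyₛ-shiftPoly N (a ∷ []) S⁻²) (Ps.*-congˡ {S⁻² ^ₛ N} (polyₛ-single a S⁻²))) ⟩
      Sinv *ₛ ((S⁻² ^ₛ N) *ₛ constₛ a)
        ≈⟨ solveₛ 3 (λ s x e → s :*ₛ (x :*ₛ e) :=ₛ e :*ₛ (s :*ₛ x)) Ps.refl Sinv (S⁻² ^ₛ N) (constₛ a) ⟩
      constₛ a *ₛ (Sinv *ₛ (S⁻² ^ₛ N))
        ≈⟨ Ps.sym (·ₛ≈constₛ-*ₛ a (Sinv *ₛ (S⁻² ^ₛ N))) ⟩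
      a ·ₛ (Sinv *ₛ (S⁻² ^ₛ N)) ∎)

    -- Induction on the polynomial: its constant term gives a pure negative odd
    -- power, and each S² factor cancels one S⁻² until a positive odd power remains.
    oddLaurent-form⇒noEvenNeg : ∀ p N → NoEvenNeg (Sinv *ₛ ((S⁻² ^ₛ N) *ₛ polyₛ p S²))
    oddLaurent-form⇒noEvenNeg []      N = noEvenNeg-cong
      (Ps.sym (Ps.trans (Ps.*-congˡ {Sinv} (Ps.zeroʳ (S⁻² ^ₛ N))) (Ps.zeroʳ Sinv)))
      (noEvenNeg-poly [])
    oddLaurent-form⇒noEvenNeg (a ∷ p) N = noEvenNeg-cong (Ps.sym split)
      (noEvenNeg-+ (noEvenNeg-Sinv*S⁻² N a) (rest N))
      where
      split : (Sinv *ₛ ((S⁻² ^ₛ N) *ₛ (constₛ a +ₛ (S² *ₛ polyₛ p S²))))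
            ≈ₛ ((a ·ₛ (Sinv *ₛ (S⁻² ^ₛ N))) +ₛ (Sinv *ₛ ((S⁻² ^ₛ N) *ₛ (S² *ₛ polyₛ p S²))))
      split = Ps.trans
        (solveₛ 5 (λ s x e q y → s :*ₛ (x :*ₛ (e :+ₛ (q :*ₛ y))) :=ₛ (e :*ₛ (s :*ₛ x)) :+ₛ (s :*ₛ (x :*ₛ (q :*ₛ y))))
          Ps.refl Sinv (S⁻² ^ₛ N) (constₛ a) S² (polyₛ p S²))
        (Ps.+-congʳ {Sinv *ₛ ((S⁻² ^ₛ N) *ₛ (S² *ₛ polyₛ p S²))} (Ps.sym (·ₛ≈constₛ-*ₛ a (Sinv *ₛ (S⁻² ^ₛ N)))))
      rest : ∀ N → NoEvenNeg (Sinv *ₛ ((S⁻² ^ₛ N) *ₛ (S² *ₛ polyₛ p S²)))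
      rest zero = noEvenNeg-cong (Ps.sym (begin
        Sinv *ₛ (oneₛ *ₛ (S² *ₛ polyₛ p S²))   ≈⟨ Ps.*-congˡ {Sinv} (Ps.*-identityˡ (S² *ₛ polyₛ p S²)) ⟩
        Sinv *ₛ (S² *ₛ polyₛ p S²)             ≈⟨ Ps.sym (Ps.*-assoc Sinv S² (polyₛ p S²)) ⟩
        (Sinv *ₛ S²) *ₛ polyₛ p S²             ≈⟨ Ps.*-congʳ {polyₛ p S²} Sinv*S²≈S ⟩
        S *ₛ polyₛ p S²                        ≈⟨ Ps.*-congˡ {S} (Ps.sym (polyₛ-spreadPoly p S)) ⟩
        S *ₛ polyₛ (spreadPoly p) S            ≈⟨ Ps.sym (polyₛ-cons0 (spreadPoly p) S) ⟩
        polyₛ (0# ∷ spreadPoly p) S            ∎)) (noEvenNeg-poly (0# ∷ spreadPoly p))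
      rest (suc N) = noEvenNeg-cong (Ps.*-congˡ {Sinv} (Ps.sym (begin
        (S⁻² *ₛ (S⁻² ^ₛ N)) *ₛ (S² *ₛ polyₛ p S²)
          ≈⟨ solveₛ 4 (λ a x b y → (a :*ₛ x) :*ₛ (b :*ₛ y) :=ₛ x :*ₛ ((a :*ₛ b) :*ₛ y))
               Ps.refl S⁻² (S⁻² ^ₛ N) S² (polyₛ p S²) ⟩
        (S⁻² ^ₛ N) *ₛ ((S⁻² *ₛ S²) *ₛ polyₛ p S²)
          ≈⟨ Ps.*-congˡ {S⁻² ^ₛ N} (Ps.trans (Ps.*-congʳ {polyₛ p S²} S⁻²*S²≈1) (Ps.*-identityˡ (polyₛ p S²))) ⟩
        (S⁻² ^ₛ N) *ₛ polyₛ p S² ∎))) (oddLaurent-form⇒noEvenNeg p N)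

    oddLaurent⇒noEvenNeg : ∀ {f} → OddLaurent f → NoEvenNeg f
    oddLaurent⇒noEvenNeg (oddLaurent N p eq) = noEvenNeg-cong (Ps.sym eq) (oddLaurent-form⇒noEvenNeg p N)

module _ {c ℓ} (K : CommutativeRing c ℓ) where
  open CommutativeRing K
  open PowerSeries K

  module SliceAlgebra (Λ : Series) where
    open FiniteSums K
    open Slices K
    module ℙΣ = FiniteSums (SeriesRing.seriesRing K)
    open import Relation.Binary.Reasoning.Setoid setoid

    𝕊-*-local : ∀ {A A′ B B′} s → (∀ r → r ≤ s → A r ≈ₛ A′ r) → (∀ r → r ≤ s → B r ≈ₛ B′ r) →
      (A 𝕊.* B) s ≈ₛ (A′ 𝕊.* B′) s
    𝕊-*-local s A≈ B≈ = ℙΣ.sumTo-cong≤ s (λ r r≤s → SeriesRing.*ₛ-cong K (A≈ r r≤s) (B≈ (s ∸ r) (ℕP.m∸n≤m s r)))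

    ^-local : ∀ {V V′} j s → (∀ r → r ≤ s → V r ≈ₛ V′ r) → (V ^ j) s ≈ₛ (V′ ^ j) s
    ^-local zero    s V≈ n = refl
    ^-local (suc j) s V≈ = 𝕊-*-local s V≈ (λ r r≤s → ^-local j r (λ r′ r′≤r → V≈ r′ (ℕP.≤-trans r′≤r r≤s)))

    interior : Slices → ℕ → Series
    interior V zero          = zeroₛ
    interior V (suc zero)    = zeroₛ
    interior V (suc (suc p)) = ℙ.sumTo p (λ r → V (suc r) *ₛ V (suc p ∸ r))

    square-slice : ∀ V p → (V 𝕊.* V) (suc p) ≈ₛ (((V 0 *ₛ V (suc p)) +ₛ (V (suc p) *ₛ V 0)) +ₛ interior V (suc p))
    square-slice V zero    n = sym (+-identityʳ _)
    square-slice V (suc p) = Ps.trans (ℙΣ.sumTo-sucˡ (suc p) (λ r → V r *ₛ V (suc (suc p) ∸ r)))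
      (Ps.trans (Ps.+-congˡ {V 0 *ₛ V (suc (suc p))} (Ps.+-congˡ {interior V (suc (suc p))}
        (SeriesRing.*ₛ-cong K {V (suc (suc p))} Ps.refl (λ n → reflexive (≡.cong (λ z → V z n) (ℕP.n∸n≡0 p))))))
      (solveₛ 3 (λ a b m → a :+ₛ (m :+ₛ b) :=ₛ (a :+ₛ b) :+ₛ m) Ps.refl
        (V 0 *ₛ V (suc (suc p))) (V (suc (suc p)) *ₛ V 0) (interior V (suc (suc p)))))
      where open SeriesAlgebra K using (module Ps; solveₛ; _:+ₛ_; _:=ₛ_)

    interior-local : ∀ {V V′} p → (∀ r → r ≤ p → V r ≈ₛ V′ r) → interior V (suc p) ≈ₛ interior V′ (suc p)
    interior-local zero    V≈ n = refl
    interior-local (suc p) V≈ = ℙΣ.sumTo-cong≤ p (λ r r≤p →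
      SeriesRing.*ₛ-cong K (V≈ (suc r) (s≤s r≤p)) (V≈ (suc p ∸ r) (ℕP.m∸n≤m (suc p) r)))

    Φ-tail : (ℕ → Slices) → ℕ → Series
    Φ-tail Z zero        = zeroₛ
    Φ-tail Z (suc q) n   = sumTo q (λ j → Λ (3 +ℕ j) * Z (3 +ℕ j) (q ∸ j) n)

    Φ-split : ∀ Z q n → Φ Λ Z q n ≈ Λ 2 * Z 2 q n + Φ-tail Z q n
    Φ-split Z zero    n = sym (+-identityʳ _)
    Φ-split Z (suc q) n = sumTo-sucˡ q _

    Φ-tail-sum : ∀ Z q → Φ-tail Z (suc q) ≈ₛ ℙ.sumTo q (λ j → Λ (3 +ℕ j) ·ₛ Z (3 +ℕ j) (q ∸ j))
    Φ-tail-sum Z q n = sym (ℙ-sumTo-at q (λ j → Λ (3 +ℕ j) ·ₛ Z (3 +ℕ j) (q ∸ j)) n)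

    Φ-cong : ∀ {Z Z′} → (∀ j q → Z j q ≈ₛ Z′ j q) → Φ Λ Z 𝕊.≈ Φ Λ Z′
    Φ-cong Z≈ q n = sumTo-cong q (λ j → *-congˡ (Z≈ (2 +ℕ j) (q ∸ j) n))

    Φ-+ : ∀ Z Z′ → Φ Λ (λ j → Z j 𝕊.+ Z′ j) 𝕊.≈ (Φ Λ Z 𝕊.+ Φ Λ Z′)
    Φ-+ Z Z′ q n = trans (sumTo-cong q (λ j → distribˡ _ _ _)) (sumTo-+ q _ _)

    Φ-neg : ∀ Z → Φ Λ (λ j → 𝕊.- Z j) 𝕊.≈ (𝕊.- Φ Λ Z)
    Φ-neg Z q n = trans (sumTo-cong q (λ j → sym (-‿distribʳ-* _ _))) (sumTo-neg q _)
      where open import Algebra.Properties.Ring ring using (-‿distribʳ-*)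

    Φ-*ˡ : ∀ A Z → Φ Λ (λ j → A 𝕊.* Z j) 𝕊.≈ (A 𝕊.* Φ Λ Z)
    Φ-*ˡ A Z q n = begin
      sumTo q (λ j → Λ (2 +ℕ j) * (A 𝕊.* Z (2 +ℕ j)) (q ∸ j) n)
        ≈⟨ sumTo-cong q (λ j → *-congˡ (ℙ-sumTo-at (q ∸ j) (λ a → A a *ₛ Z (2 +ℕ j) (q ∸ j ∸ a)) n)) ⟩
      sumTo q (λ j → Λ (2 +ℕ j) * sumTo (q ∸ j) (λ a → (A a *ₛ Z (2 +ℕ j) (q ∸ j ∸ a)) n))
        ≈⟨ sumTo-cong q (λ j → sym (sumTo-*ˡ (q ∸ j) _ _)) ⟩
      sumTo q (λ j → sumTo (q ∸ j) (λ a → Λ (2 +ℕ j) * (A a *ₛ Z (2 +ℕ j) (q ∸ j ∸ a)) n))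
        ≈⟨ sumTo-triangle-swap q _ ⟩
      sumTo q (λ a → sumTo (q ∸ a) (λ j → Λ (2 +ℕ j) * (A a *ₛ Z (2 +ℕ j) (q ∸ j ∸ a)) n))
        ≈⟨ sumTo-cong q (λ a → sumTo-cong (q ∸ a) (λ j → distribute a j)) ⟩
      sumTo q (λ a → sumTo (q ∸ a) (λ j → sumTo n (λ i → A a i * (Λ (2 +ℕ j) * Z (2 +ℕ j) (q ∸ a ∸ j) (n ∸ i)))))
        ≈⟨ sumTo-cong q (λ a → sumTo-swap (q ∸ a) n _) ⟩
      sumTo q (λ a → sumTo n (λ i → sumTo (q ∸ a) (λ j → A a i * (Λ (2 +ℕ j) * Z (2 +ℕ j) (q ∸ a ∸ j) (n ∸ i)))))
        ≈⟨ sumTo-cong q (λ a → sumTo-cong n (λ i → sumTo-*ˡ (q ∸ a) _ _)) ⟩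
      sumTo q (λ a → (A a *ₛ Φ Λ Z (q ∸ a)) n)
        ≈⟨ ℙ-sumTo-at q (λ a → A a *ₛ Φ Λ Z (q ∸ a)) n ⟨
      (A 𝕊.* Φ Λ Z) q n ∎
      where
      ∸-comm : ∀ q j a → q ∸ j ∸ a ≡ q ∸ a ∸ j
      ∸-comm q j a = ≡.trans (ℕP.∸-+-assoc q j a)
        (≡.trans (≡.cong (q ∸_) (ℕP.+-comm j a)) (≡.sym (ℕP.∸-+-assoc q a j)))
      distribute : ∀ a j → Λ (2 +ℕ j) * (A a *ₛ Z (2 +ℕ j) (q ∸ j ∸ a)) n
        ≈ sumTo n (λ i → A a i * (Λ (2 +ℕ j) * Z (2 +ℕ j) (q ∸ a ∸ j) (n ∸ i)))
      distribute a j = trans (sym (sumTo-*ˡ n _ _)) (sumTo-cong n (λ i →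
        trans (sym (*-assoc _ _ _)) (trans (*-congʳ (*-comm _ _)) (trans (*-assoc _ _ _)
          (*-congˡ (*-congˡ (reflexive (≡.cong (λ z → Z (2 +ℕ j) z (n ∸ i)) (∸-comm q j a)))))))))

module _ {c ℓ} (K : CommutativeRing c ℓ) where
  open CommutativeRing K
  open PowerSeries K

  -- The branch W̃₀ = (1 + S)/(2λ₂); for q ≥ 1 the slice equation is linear in W̃_q,
  -- with coefficient 1 − 2λ₂W̃₀ = −S.
  module SecondSolution (Λ : Series) (S Sinv : Series)
    (S²≈ : (S *ₛ S) ≈ₛ (oneₛ -ₛ (((4 ·ℕ 1#) * Λ 2) ·ₛ tₛ))) (S*Sinv≈1 : (S *ₛ Sinv) ≈ₛ oneₛ)
    (e₀ : Carrier) (2λ₂e₀≈1 : ((1# + 1#) * Λ 2) * e₀ ≈ 1#) where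
    open FiniteSums K
    open SeriesAlgebra K
    open Slices K
    open SliceAlgebra K Λ
    open RingSolver K using () renaming (solve to solveK; _:*_ to _:*K_; _:=_ to _:=K_)
    open import Algebra.Properties.Semiring.Mult semiring using (×1-homo-*)
    open import Relation.Binary.Reasoning.Setoid Ps.setoid

    λ₂ : Carrier
    λ₂ = Λ 2

    e l f4 O : Series
    e = constₛ e₀
    l = constₛ λ₂
    f4 = constₛ ((4 ·ℕ 1#) * λ₂)
    O = ⟦ (1 , 0) ⟧ℤₛ

    O≈1 : O ≈ₛ oneₛ
    O≈1 = ⟦1⟧ℤ≈oneₛ

    [1+1]le≈1 : ((O +ₛ O) *ₛ (l *ₛ e)) ≈ₛ O
    [1+1]le≈1 = Ps.trans (Ps.*-congʳ {l *ₛ e} (Ps.+-cong O≈1 O≈1)) (Ps.trans (Ps.trans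
      (Ps.*-congʳ {l *ₛ e} (Ps.sym (Ps.trans (constₛ-+ 1# 1#) (Ps.+-cong constₛ-1 constₛ-1))))
      (Ps.trans (Ps.*-congˡ {constₛ (1# + 1#)} (Ps.sym (constₛ-* λ₂ e₀)))
        (Ps.trans (Ps.sym (constₛ-* (1# + 1#) (λ₂ * e₀)))
          (Ps.trans (constₛ-cong (trans (sym (*-assoc _ _ _)) 2λ₂e₀≈1)) constₛ-1)))) (Ps.sym O≈1))

    lee4λ₂≈1 : (l *ₛ (e *ₛ (e *ₛ f4))) ≈ₛ O
    lee4λ₂≈1 = Ps.trans (Ps.*-congˡ {l} (Ps.*-congˡ {e} (Ps.sym (constₛ-* e₀ _))))
      (Ps.trans (Ps.*-congˡ {l} (Ps.sym (constₛ-* e₀ (e₀ * _))))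
      (Ps.trans (Ps.sym (constₛ-* λ₂ (e₀ * (e₀ * _)))) (Ps.trans (constₛ-cong λ₂e₀e₀4λ₂≈1)
      (Ps.trans constₛ-1 (Ps.sym O≈1)))))
      where
      two≈ : (2 ·ℕ 1#) ≈ (1# + 1#)
      two≈ = +-congˡ (+-identityʳ 1#)
      λ₂e₀e₀4λ₂≈1 : λ₂ * (e₀ * (e₀ * ((4 ·ℕ 1#) * λ₂))) ≈ 1#
      λ₂e₀e₀4λ₂≈1 = trans (*-congˡ (*-congˡ (*-congˡ (*-congʳ (trans (×1-homo-* 2 2) (*-cong two≈ two≈))))))
        (trans (solveK 3 (λ l e t → l :*K (e :*K (e :*K ((t :*K t) :*K l))) :=K ((t :*K l) :*K e) :*K ((t :*K l) :*K e))
                         refl λ₂ e₀ (1# + 1#))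
               (trans (*-cong 2λ₂e₀≈1 2λ₂e₀≈1) (*-identityˡ 1#)))

    S²≈1-4λ₂t : (S *ₛ S) ≈ₛ (O Ps.- (f4 *ₛ tₛ))
    S²≈1-4λ₂t = Ps.trans S²≈ (Ps.+-cong (Ps.sym O≈1) (Ps.-‿cong (·ₛ≈constₛ-*ₛ _ tₛ)))

    quadratic-root : ∀ T → (T *ₛ T) ≈ₛ (S *ₛ S) →
      (e *ₛ (O +ₛ T)) ≈ₛ (tₛ +ₛ (l *ₛ ((e *ₛ (O +ₛ T)) *ₛ (e *ₛ (O +ₛ T)))))
    quadratic-root T T²≈S² = Ps.sym (begin
      tₛ +ₛ (l *ₛ (X *ₛ X))
        ≈⟨ solveₛ 5 (λ t l e T f → t :+ₛ (l :*ₛ ((e :*ₛ (conₛ (1 , 0) :+ₛ T)) :*ₛ (e :*ₛ (conₛ (1 , 0) :+ₛ T))))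
             :=ₛ t :+ₛ ((((conₛ (1 , 0) :+ₛ conₛ (1 , 0)) :*ₛ (l :*ₛ e)) :*ₛ (e :*ₛ (conₛ (1 , 0) :+ₛ T)))
               :+ₛ (((l :*ₛ (e :*ₛ e)) :*ₛ ((T :*ₛ T) :-ₛ (conₛ (1 , 0) :-ₛ (f :*ₛ t))))
               :-ₛ ((l :*ₛ (e :*ₛ (e :*ₛ f))) :*ₛ t)))) Ps.refl tₛ l e T f4 ⟩
      tₛ +ₛ ((((O +ₛ O) *ₛ (l *ₛ e)) *ₛ X)
            +ₛ (((l *ₛ (e *ₛ e)) *ₛ ((T *ₛ T) Ps.- (O Ps.- (f4 *ₛ tₛ)))) Ps.- ((l *ₛ (e *ₛ (e *ₛ f4))) *ₛ tₛ)))
        ≈⟨ Ps.+-congˡ {tₛ} (Ps.+-cong (Ps.*-congʳ {X} [1+1]le≈1)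
             (Ps.+-cong (Ps.*-congˡ {l *ₛ (e *ₛ e)} (Ps.trans (Ps.+-congʳ {Ps.- (O Ps.- (f4 *ₛ tₛ))} (Ps.trans T²≈S² S²≈1-4λ₂t))
                                                                  (Ps.-‿inverseʳ (O Ps.- (f4 *ₛ tₛ)))))
                        (Ps.-‿cong (Ps.*-congʳ {tₛ} lee4λ₂≈1)))) ⟩
      tₛ +ₛ ((O *ₛ X) +ₛ (((l *ₛ (e *ₛ e)) *ₛ zeroₛ) Ps.- (O *ₛ tₛ)))
        ≈⟨ Ps.+-congˡ {tₛ} (Ps.+-congˡ {O *ₛ X} (Ps.trans (Ps.+-congʳ {Ps.- (O *ₛ tₛ)} (Ps.zeroʳ (l *ₛ (e *ₛ e))))
             (Ps.+-identityˡ (Ps.- (O *ₛ tₛ))))) ⟩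
      tₛ +ₛ ((O *ₛ X) +ₛ (Ps.- (O *ₛ tₛ)))
        ≈⟨ solveₛ 2 (λ t X → t :+ₛ ((conₛ (1 , 0) :*ₛ X) :+ₛ (:-ₛ (conₛ (1 , 0) :*ₛ t))) :=ₛ X) Ps.refl tₛ X ⟩
      X ∎)
      where X = e *ₛ (O +ₛ T)

    Φ-slice-zero : ∀ V → (λ n → Φ Λ (V ^_) 0 n) ≈ₛ (l *ₛ (V 0 *ₛ V 0))
    Φ-slice-zero V = Ps.trans (λ n → *-congˡ (Ps.*-congˡ {V 0} (Ps.*-identityʳ (V 0)) n)) (·ₛ≈constₛ-*ₛ λ₂ (V 0 *ₛ V 0))

    Φ-slice-suc : ∀ V p → (λ n → Φ Λ (V ^_) (suc p) n)
      ≈ₛ ((l *ₛ (((V 0 *ₛ V (suc p)) +ₛ (V (suc p) *ₛ V 0)) +ₛ interior V (suc p))) +ₛ Φ-tail (V ^_) (suc p))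
    Φ-slice-suc V p = Ps.trans (λ n → Φ-split (V ^_) (suc p) n)
      (Ps.+-congʳ {Φ-tail (V ^_) (suc p)} (Ps.trans
        (λ n → *-congˡ (Ps.trans (𝕊.*-congˡ {V} (𝕊.*-identityʳ V) (suc p)) (square-slice V p) n))
        (·ₛ≈constₛ-*ₛ λ₂ (((V 0 *ₛ V (suc p)) +ₛ (V (suc p) *ₛ V 0)) +ₛ interior V (suc p)))))

    private
      step : (ℕ → Series) → (ℕ → Series)
      step V zero    = e *ₛ (O +ₛ S)
      step V (suc p) = (Ps.- Sinv) *ₛ ((l *ₛ interior V (suc p)) +ₛ Φ-tail (V ^_) (suc p))

      step-guarded : ∀ V V′ q → (∀ p → p < q → V p ≈ₛ V′ p) → step V q ≈ₛ step V′ q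
      step-guarded V V′ zero    _  = Ps.refl
      step-guarded V V′ (suc p) V≈ = Ps.*-congˡ {Ps.- Sinv} (Ps.+-cong
        (Ps.*-congˡ {l} (interior-local p (λ r r≤p → V≈ r (s≤s r≤p))))
        (λ n → sumTo-cong p (λ j → *-congˡ {Λ (3 +ℕ j)}
          (^-local (3 +ℕ j) (p ∸ j) (λ r r≤ → V≈ r (s≤s (ℕP.≤-trans r≤ (ℕP.m∸n≤m p j)))) n))))

    open GuardedFixpoint Ps.setoid zeroₛ step step-guarded using (fix; fix-unfold)

    W̃ : Slices
    W̃ = fix

    W̃₀ : W̃ 0 ≈ₛ (e *ₛ (O +ₛ S))
    W̃₀ = fix-unfold 0

    linear-slice : ∀ w v m r → w ≈ₛ (e *ₛ (O +ₛ S)) → v ≈ₛ ((Ps.- Sinv) *ₛ ((l *ₛ m) +ₛ r)) →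
      v ≈ₛ ((l *ₛ (((w *ₛ v) +ₛ (v *ₛ w)) +ₛ m)) +ₛ r)
    linear-slice w v m r w≈ v≈ = Ps.sym (begin
      (l *ₛ (((w *ₛ v) +ₛ (v *ₛ w)) +ₛ m)) +ₛ r
        ≈⟨ solveₛ 5 (λ l w v m r → (l :*ₛ (((w :*ₛ v) :+ₛ (v :*ₛ w)) :+ₛ m)) :+ₛ r
             :=ₛ (l :*ₛ ((w :*ₛ v) :+ₛ (v :*ₛ w))) :+ₛ ((l :*ₛ m) :+ₛ r)) Ps.refl l w v m r ⟩
      (l *ₛ ((w *ₛ v) +ₛ (v *ₛ w))) +ₛ ((l *ₛ m) +ₛ r)
        ≈⟨ Ps.+-cong (Ps.*-congˡ {l} (Ps.+-cong (Ps.*-congʳ {v} w≈) (Ps.*-congˡ {v} w≈))) (Ps.sym -Sv≈) ⟩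
      (l *ₛ (((e *ₛ (O +ₛ S)) *ₛ v) +ₛ (v *ₛ (e *ₛ (O +ₛ S))))) +ₛ ((Ps.- S) *ₛ v)
        ≈⟨ solveₛ 4 (λ l e S v → (l :*ₛ (((e :*ₛ (conₛ (1 , 0) :+ₛ S)) :*ₛ v) :+ₛ (v :*ₛ (e :*ₛ (conₛ (1 , 0) :+ₛ S)))))
               :+ₛ ((:-ₛ S) :*ₛ v)
             :=ₛ ((((conₛ (1 , 0) :+ₛ conₛ (1 , 0)) :*ₛ (l :*ₛ e)) :*ₛ (conₛ (1 , 0) :+ₛ S)) :*ₛ v) :-ₛ (S :*ₛ v))
             Ps.refl l e S v ⟩
      ((((O +ₛ O) *ₛ (l *ₛ e)) *ₛ (O +ₛ S)) *ₛ v) Ps.- (S *ₛ v)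
        ≈⟨ Ps.+-congʳ {Ps.- (S *ₛ v)} (Ps.*-congʳ {v} (Ps.*-congʳ {O +ₛ S} [1+1]le≈1)) ⟩
      ((O *ₛ (O +ₛ S)) *ₛ v) Ps.- (S *ₛ v)
        ≈⟨ solveₛ 2 (λ S v → ((conₛ (1 , 0) :*ₛ (conₛ (1 , 0) :+ₛ S)) :*ₛ v) :-ₛ (S :*ₛ v) :=ₛ v) Ps.refl S v ⟩
      v ∎)
      where
      -Sv≈ : ((Ps.- S) *ₛ v) ≈ₛ ((l *ₛ m) +ₛ r)
      -Sv≈ = Ps.trans (Ps.*-congˡ {Ps.- S} v≈)
        (Ps.trans (solveₛ 3 (λ S Si R → (:-ₛ S) :*ₛ ((:-ₛ Si) :*ₛ R) :=ₛ (S :*ₛ Si) :*ₛ R) Ps.refl S Sinv ((l *ₛ m) +ₛ r))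
                  (Ps.trans (Ps.*-congʳ {(l *ₛ m) +ₛ r} S*Sinv≈1) (Ps.*-identityˡ ((l *ₛ m) +ₛ r))))

    W̃-slice-equation : SliceEquation Λ W̃
    W̃-slice-equation zero = begin
      W̃ 0                                       ≈⟨ W̃₀ ⟩
      e *ₛ (O +ₛ S)                             ≈⟨ quadratic-root S Ps.refl ⟩
      tₛ +ₛ (l *ₛ ((e *ₛ (O +ₛ S)) *ₛ (e *ₛ (O +ₛ S))))
                                                ≈⟨ Ps.+-congˡ {tₛ} (Ps.*-congˡ {l} (Ps.sym (Ps.*-cong W̃₀ W̃₀))) ⟩
      tₛ +ₛ (l *ₛ (W̃ 0 *ₛ W̃ 0))                ≈⟨ Ps.+-congˡ {tₛ} (Ps.sym (Φ-slice-zero W̃)) ⟩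
      (λ n → tₛ n + Φ Λ (W̃ ^_) 0 n)             ∎
    W̃-slice-equation (suc p) = begin
      W̃ (suc p)
        ≈⟨ linear-slice (W̃ 0) (W̃ (suc p)) (interior W̃ (suc p)) (Φ-tail (W̃ ^_) (suc p)) W̃₀ (fix-unfold (suc p)) ⟩
      (l *ₛ (((W̃ 0 *ₛ W̃ (suc p)) +ₛ (W̃ (suc p) *ₛ W̃ 0)) +ₛ interior W̃ (suc p))) +ₛ Φ-tail (W̃ ^_) (suc p)
        ≈⟨ Ps.sym (Φ-slice-suc W̃ p) ⟩
      (λ n → Φ Λ (W̃ ^_) (suc p) n)
        ≈⟨ (λ n → sym (+-identityˡ _)) ⟩
      (λ n → zeroₛ n + Φ Λ (W̃ ^_) (suc p) n) ∎

module _ {c ℓ} (K : CommutativeRing c ℓ) where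
  open CommutativeRing K
  open PowerSeries K

  module LaurentStructure (isField : IsField) (char0 : CharZero) (Λ : Series) (λ₂≉0 : ¬ (Λ 2 ≈ 0#))
    (S Sinv : Series) (S₀≈1 : S 0 ≈ 1#)
    (S²≈ : (S *ₛ S) ≈ₛ (oneₛ -ₛ (((4 ·ℕ 1#) * Λ 2) ·ₛ tₛ))) (S*Sinv≈1 : (S *ₛ Sinv) ≈ₛ oneₛ)
    (V : Slices.Slices K) (V-eq : Slices.SliceEquation K Λ V) (V₀₀≈0 : V 0 0 ≈ 0#) where
    open FiniteSums K
    open SeriesAlgebra K
    open Slices K
    open SliceAlgebra K Λ
    open FieldLemmas K isField
    open import Algebra.Properties.Ring ring using (-0#≈0#)
    open RingSolver K using () renaming (solve to solveK; _:+_ to _:+K_; _:*_ to _:*K_; _:-_ to _:-K_; _:=_ to _:=K_;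
                                         con to conK; ⟦1⟧ℤ≈1 to ⟦1⟧ℤ≈1#)
    open RingSolver sliceRing using () renaming (solve to solve𝕊; _:+_ to _:+𝕊_; _:*_ to _:*𝕊_; _:-_ to _:-𝕊_; _:=_ to _:=𝕊_)
    open import Relation.Binary.Reasoning.Setoid Ps.setoid

    two : Carrier
    two = 1# + 1#

    two≉0 : ¬ (two ≈ 0#)
    two≉0 two≈0 = ℕP.0≢1+n (≡.sym (char0 2 (trans (+-congˡ (+-identityʳ 1#)) two≈0)))

    4λ₂≉0 : ¬ ((4 ·ℕ 1#) * Λ 2 ≈ 0#)
    4λ₂≉0 = *-≉0 (λ 4≈0 → ℕP.0≢1+n (≡.sym (char0 4 4≈0))) λ₂≉0

    e₀ : Carrier
    e₀ = inverse (two * Λ 2) (*-≉0 two≉0 λ₂≉0)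

    open SecondSolution K Λ S Sinv S²≈ S*Sinv≈1 e₀ (*-inverseʳ (two * Λ 2) (*-≉0 two≉0 λ₂≉0))
    open ParityClasses K S Sinv S*Sinv≈1

    -- Slice 0 of V is the root of X = t + λ₂X² vanishing at t = 0, namely (1 − S)/(2λ₂).
    V₀≈ : V 0 ≈ₛ (e *ₛ (O +ₛ (Ps.- S)))
    V₀≈ = Ps.trans (Ps.sym (Ps.+-identityʳ (V 0))) (Ps.trans (Ps.+-congˡ {V 0} (Ps.sym (Ps.-‿inverseˡ w₀)))
      (Ps.trans (Ps.sym (Ps.+-assoc (V 0) (Ps.- w₀) w₀)) (Ps.trans (Ps.+-congʳ {w₀} V₀-w₀≈0) (Ps.+-identityˡ w₀))))
      where
      w₀ = e *ₛ (O +ₛ (Ps.- S))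
      V₀-eq : V 0 ≈ₛ (tₛ +ₛ (l *ₛ (V 0 *ₛ V 0)))
      V₀-eq = Ps.trans (V-eq 0) (Ps.+-congˡ {tₛ} (Φ-slice-zero V))
      w₀-eq : w₀ ≈ₛ (tₛ +ₛ (l *ₛ (w₀ *ₛ w₀)))
      w₀-eq = quadratic-root (Ps.- S) (solveₛ 1 (λ s → (:-ₛ s) :*ₛ (:-ₛ s) :=ₛ s :*ₛ s) Ps.refl S)
      factor : Series
      factor = O Ps.- (l *ₛ (V 0 +ₛ w₀))
      factorisation : (factor *ₛ (V 0 Ps.- w₀)) ≈ₛ zeroₛ
      factorisation = Ps.trans
        (solveₛ 4 (λ l a b t → (conₛ (1 , 0) :-ₛ (l :*ₛ (a :+ₛ b))) :*ₛ (a :-ₛ b)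
                     :=ₛ (a :-ₛ (t :+ₛ (l :*ₛ (a :*ₛ a)))) :-ₛ (b :-ₛ (t :+ₛ (l :*ₛ (b :*ₛ b)))))
                   Ps.refl l (V 0) w₀ tₛ)
        (Ps.trans (Ps.+-cong (Ps.trans (Ps.+-congˡ {V 0} (Ps.-‿cong (Ps.sym V₀-eq))) (Ps.-‿inverseʳ (V 0)))
                             (Ps.-‿cong (Ps.trans (Ps.+-congˡ {w₀} (Ps.-‿cong (Ps.sym w₀-eq))) (Ps.-‿inverseʳ w₀))))
                  (Ps.-‿inverseʳ zeroₛ))
      w₀₀≈0 : w₀ 0 ≈ 0#
      w₀₀≈0 = trans (*-congˡ (trans (+-cong (⟦1⟧ℤ≈oneₛ 0) (-‿cong S₀≈1)) (-‿inverseʳ 1#))) (zeroʳ _)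
      factor₀≈1 : factor 0 * 1# ≈ 1#
      factor₀≈1 = trans (*-identityʳ _) (trans (+-cong (⟦1⟧ℤ≈oneₛ 0)
        (-‿cong (trans (*-congˡ (trans (+-cong V₀₀≈0 w₀₀≈0) (+-identityʳ 0#))) (zeroʳ _))))
        (trans (+-congˡ -0#≈0#) (+-identityʳ 1#)))
      V₀-w₀≈0 : (V 0 Ps.- w₀) ≈ₛ zeroₛ
      V₀-w₀≈0 = SeriesCancellation.*ₛ-≈0-cancelˡ K factor (V 0 Ps.- w₀) 1# factorisation factor₀≈1

    D σ₁ σ₂ : Slices
    D = V 𝕊.- W̃
    σ₁ = V 𝕊.+ W̃
    σ₂ = V 𝕊.* W̃

    D₀≈ : D 0 ≈ₛ (Ps.- ((S +ₛ S) *ₛ e))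
    D₀≈ = Ps.trans (Ps.+-cong V₀≈ (Ps.-‿cong W̃₀))
      (solveₛ 3 (λ e o s → (e :*ₛ (o :+ₛ (:-ₛ s))) :-ₛ (e :*ₛ (o :+ₛ s)) :=ₛ :-ₛ ((s :+ₛ s) :*ₛ e)) Ps.refl e O S)

    D₀⁻¹ : Series
    D₀⁻¹ = (Ps.- l) *ₛ Sinv

    D₀*D₀⁻¹≈1 : (D 0 *ₛ D₀⁻¹) ≈ₛ O
    D₀*D₀⁻¹≈1 = Ps.trans (Ps.*-congʳ {D₀⁻¹} D₀≈)
      (Ps.trans (solveₛ 4 (λ e s l s⁻¹ → (:-ₛ ((s :+ₛ s) :*ₛ e)) :*ₛ ((:-ₛ l) :*ₛ s⁻¹)
                              :=ₛ ((conₛ (1 , 0) :+ₛ conₛ (1 , 0)) :*ₛ (l :*ₛ e)) :*ₛ (s :*ₛ s⁻¹)) Ps.refl e S l Sinv)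
        (Ps.trans (Ps.*-cong [1+1]le≈1 S*Sinv≈1)
          (Ps.trans (Ps.*-congˡ {O} (Ps.sym O≈1)) (Ps.trans (Ps.*-congʳ {O} O≈1) (Ps.*-identityˡ O)))))

    -- quotient j = (Vʲ − W̃ʲ)/(V − W̃) = Σ_{i<j} V^(j−1−i) W̃ⁱ
    quotient : ℕ → Slices
    quotient zero    = 𝕊.0#
    quotient (suc j) = (V ^ j) 𝕊.+ (W̃ 𝕊.* quotient j)

    ^-difference : ∀ j → ((V ^ j) 𝕊.- (W̃ ^ j)) 𝕊.≈ (D 𝕊.* quotient j)
    ^-difference zero    = 𝕊.trans (𝕊.-‿inverseʳ 𝕊.1#) (𝕊.sym (𝕊.zeroʳ D))
    ^-difference (suc j) = 𝕊.trans
      (solve𝕊 5 (λ v w a b h → (v :*𝕊 a) :-𝕊 (w :*𝕊 b)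
                    :=𝕊 ((v :-𝕊 w) :*𝕊 (a :+𝕊 (w :*𝕊 h))) :+𝕊 (w :*𝕊 ((a :-𝕊 b) :-𝕊 ((v :-𝕊 w) :*𝕊 h))))
         𝕊.refl V W̃ (V ^ j) (W̃ ^ j) (quotient j))
      (𝕊.trans (𝕊.+-congˡ {D 𝕊.* quotient (suc j)} (𝕊.trans (𝕊.*-congˡ {W̃}
          (𝕊.trans (𝕊.+-congʳ {𝕊.- (D 𝕊.* quotient j)} (^-difference j)) (𝕊.-‿inverseʳ (D 𝕊.* quotient j))))
          (𝕊.zeroʳ W̃)))
        (𝕊.+-identityʳ (D 𝕊.* quotient (suc j))))

    D≈D*Φquotient : D 𝕊.≈ (D 𝕊.* Φ Λ quotient)
    D≈D*Φquotient = 𝕊.trans (𝕊.+-cong V-eq (𝕊.-‿cong W̃-slice-equation))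
      (𝕊.trans (solve𝕊 3 (λ x a b → (x :+𝕊 a) :-𝕊 (x :+𝕊 b) :=𝕊 a :-𝕊 b) 𝕊.refl tSlice (Φ Λ (V ^_)) (Φ Λ (W̃ ^_)))
      (𝕊.trans (𝕊.sym (𝕊.trans (Φ-+ (V ^_) (λ j → 𝕊.- (W̃ ^ j))) (𝕊.+-congˡ {Φ Λ (V ^_)} (Φ-neg (W̃ ^_)))))
      (𝕊.trans (Φ-cong (λ j q → ^-difference j q)) (Φ-*ˡ D quotient))))

    -- D has an invertible leading slice, so it can be cancelled.
    Φquotient≈1 : Φ Λ quotient 𝕊.≈ 𝕊.1#
    Φquotient≈1 = 𝕊.trans (𝕊.sym (𝕊.+-identityʳ G)) (𝕊.trans (𝕊.+-congˡ {G} (𝕊.sym 1-G≈0))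
      (solve𝕊 2 (λ g o → g :+𝕊 (o :-𝕊 g) :=𝕊 o) 𝕊.refl G 𝕊.1#))
      where
      G = Φ Λ quotient
      D*[1-G]≈0 : (D 𝕊.* (𝕊.1# 𝕊.- G)) 𝕊.≈ 𝕊.0#
      D*[1-G]≈0 = 𝕊.trans (solve𝕊 3 (λ d o g → d :*𝕊 (o :-𝕊 g) :=𝕊 (d :*𝕊 o) :-𝕊 (d :*𝕊 g)) 𝕊.refl D 𝕊.1# G)
        (𝕊.trans (𝕊.+-congʳ {𝕊.- (D 𝕊.* G)} (𝕊.*-identityʳ D))
          (𝕊.trans (𝕊.+-congˡ {D} (𝕊.-‿cong (𝕊.sym D≈D*Φquotient))) (𝕊.-‿inverseʳ D)))
      1-G≈0 : (𝕊.1# 𝕊.- G) 𝕊.≈ 𝕊.0#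
      1-G≈0 = SeriesCancellation.*ₛ-≈0-cancelˡ (SeriesRing.seriesRing K) D (𝕊.1# 𝕊.- G) D₀⁻¹ D*[1-G]≈0
        (Ps.trans D₀*D₀⁻¹≈1 O≈1)

    i4 : Carrier
    i4 = inverse ((4 ·ℕ 1#) * λ₂) 4λ₂≉0

    t-evenPoly : EvenPoly tₛ
    t-evenPoly = evenPoly (i4 ∷ (- i4) ∷ []) (Ps.sym (begin
      constₛ i4 +ₛ (S² *ₛ polyₛ ((- i4) ∷ []) S²)
        ≈⟨ Ps.+-congˡ {constₛ i4} (Ps.*-cong S²≈1-4λ₂t (Ps.trans (polyₛ-single (- i4) S²) (constₛ-neg i4))) ⟩
      constₛ i4 +ₛ ((O Ps.- (f4 *ₛ tₛ)) *ₛ (Ps.- constₛ i4))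
        ≈⟨ solveₛ 3 (λ i f t → i :+ₛ ((conₛ (1 , 0) :-ₛ (f :*ₛ t)) :*ₛ (:-ₛ i)) :=ₛ (f :*ₛ i) :*ₛ t)
             Ps.refl (constₛ i4) f4 tₛ ⟩
      (f4 *ₛ constₛ i4) *ₛ tₛ
        ≈⟨ Ps.*-congʳ {tₛ} (Ps.trans (Ps.sym (constₛ-* _ i4)) (Ps.trans (constₛ-cong (*-inverseʳ _ 4λ₂≉0)) constₛ-1)) ⟩
      oneₛ *ₛ tₛ
        ≈⟨ Ps.*-identityˡ tₛ ⟩
      tₛ ∎))

    tSlice-evenPoly : ∀ s → EvenPoly (tSlice s)
    tSlice-evenPoly zero    = t-evenPoly
    tSlice-evenPoly (suc s) = evenPoly-0

    EvenBelow : Slices → ℕ → Set (c ⊔ ℓ)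
    EvenBelow A s = ∀ p → p < s → EvenPoly (A p)

    evenBelow-cong : ∀ {A B s} → A 𝕊.≈ B → EvenBelow A s → EvenBelow B s
    evenBelow-cong A≈B even p p<s = evenPoly-cong (A≈B p) (even p p<s)

    evenBelow-1 : ∀ {s} → EvenBelow 𝕊.1# s
    evenBelow-1 zero    _ = evenPoly-1
    evenBelow-1 (suc p) _ = evenPoly-0

    evenBelow-+ : ∀ {A B s} → EvenBelow A s → EvenBelow B s → EvenBelow (A 𝕊.+ B) s
    evenBelow-+ A-even B-even p p<s = evenPoly-+ (A-even p p<s) (B-even p p<s)

    evenBelow-sub : ∀ {A B s} → EvenBelow A s → EvenBelow B s → EvenBelow (A 𝕊.- B) s
    evenBelow-sub A-even B-even p p<s = evenPoly-sub (A-even p p<s) (B-even p p<s)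

    evenBelow-* : ∀ {A B s} → EvenBelow A s → EvenBelow B s → EvenBelow (A 𝕊.* B) s
    evenBelow-* {A} {B} A-even B-even p p<s = evenPoly-sumTo p (λ r → A r *ₛ B (p ∸ r)) (λ r r≤p →
      evenPoly-* (A-even r (ℕP.≤-<-trans r≤p p<s)) (B-even (p ∸ r) (ℕP.≤-<-trans (ℕP.m∸n≤m p r) p<s)))

    Φ-tail-evenPoly : ∀ Z s → (∀ j → EvenBelow (Z j) s) → EvenPoly (Φ-tail Z s)
    Φ-tail-evenPoly Z zero    _    = evenPoly-0
    Φ-tail-evenPoly Z (suc s) even = evenPoly-cong (Ps.sym (Φ-tail-sum Z s))
      (evenPoly-sumTo s _ (λ j j≤s → evenPoly-· (Λ (3 +ℕ j)) (even (3 +ℕ j) (s ∸ j) (s≤s (ℕP.m∸n≤m s j)))))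

    -- Both the quotients (Vʲ − W̃ʲ)/(V − W̃) and the power sums Vʲ + W̃ʲ satisfy
    -- Xⱼ₊₂ = σ₁ Xⱼ₊₁ − σ₂ Xⱼ, hence are polynomials in σ₁ and σ₂.
    recurrence : Slices → Slices → ℕ → Slices
    recurrence X₀ X₁ zero          = X₀
    recurrence X₀ X₁ (suc zero)    = X₁
    recurrence X₀ X₁ (suc (suc j)) = (σ₁ 𝕊.* recurrence X₀ X₁ (suc j)) 𝕊.- (σ₂ 𝕊.* recurrence X₀ X₁ j)

    satisfies-recurrence : ∀ (X : ℕ → Slices) → (∀ j → X (2 +ℕ j) 𝕊.≈ ((σ₁ 𝕊.* X (suc j)) 𝕊.- (σ₂ 𝕊.* X j))) →
      ∀ j → X j 𝕊.≈ recurrence (X 0) (X 1) j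
    satisfies-recurrence X X-rec j = proj₁ (pair j)
      where
      pair : ∀ j → (X j 𝕊.≈ recurrence (X 0) (X 1) j) × (X (suc j) 𝕊.≈ recurrence (X 0) (X 1) (suc j))
      pair zero    = 𝕊.refl , 𝕊.refl
      pair (suc j) = proj₂ (pair j) , 𝕊.trans (X-rec j)
        (𝕊.+-cong (𝕊.*-congˡ {σ₁} (proj₂ (pair j))) (𝕊.-‿cong (𝕊.*-congˡ {σ₂} (proj₁ (pair j)))))

    evenBelow-recurrence : ∀ {s X₀ X₁} → EvenBelow σ₁ s → EvenBelow σ₂ s → EvenBelow X₀ s → EvenBelow X₁ s →
      ∀ j → EvenBelow (recurrence X₀ X₁ j) s
    evenBelow-recurrence σ₁-even σ₂-even X₀-even X₁-even zero          = X₀-even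
    evenBelow-recurrence σ₁-even σ₂-even X₀-even X₁-even (suc zero)    = X₁-even
    evenBelow-recurrence σ₁-even σ₂-even X₀-even X₁-even (suc (suc j)) =
      evenBelow-sub (evenBelow-* σ₁-even (evenBelow-recurrence σ₁-even σ₂-even X₀-even X₁-even (suc j)))
                  (evenBelow-* σ₂-even (evenBelow-recurrence σ₁-even σ₂-even X₀-even X₁-even j))

    quotient-recurrence : ∀ j → quotient (2 +ℕ j) 𝕊.≈ ((σ₁ 𝕊.* quotient (suc j)) 𝕊.- (σ₂ 𝕊.* quotient j))
    quotient-recurrence j = solve𝕊 4 (λ v w a h → (v :*𝕊 a) :+𝕊 (w :*𝕊 (a :+𝕊 (w :*𝕊 h)))
        :=𝕊 ((v :+𝕊 w) :*𝕊 (a :+𝕊 (w :*𝕊 h))) :-𝕊 ((v :*𝕊 w) :*𝕊 h))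
      𝕊.refl V W̃ (V ^ j) (quotient j)

    powerSum : ℕ → Slices
    powerSum j = (V ^ j) 𝕊.+ (W̃ ^ j)

    powerSum-recurrence : ∀ j → powerSum (2 +ℕ j) 𝕊.≈ ((σ₁ 𝕊.* powerSum (suc j)) 𝕊.- (σ₂ 𝕊.* powerSum j))
    powerSum-recurrence j = solve𝕊 4 (λ v w a b → (v :*𝕊 (v :*𝕊 a)) :+𝕊 (w :*𝕊 (w :*𝕊 b))
        :=𝕊 ((v :+𝕊 w) :*𝕊 ((v :*𝕊 a) :+𝕊 (w :*𝕊 b))) :-𝕊 ((v :*𝕊 w) :*𝕊 (a :+𝕊 b)))
      𝕊.refl V W̃ (V ^ j) (W̃ ^ j)

    quotient-evenBelow : ∀ {s} → EvenBelow σ₁ s → EvenBelow σ₂ s → ∀ j → EvenBelow (quotient j) s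
    quotient-evenBelow σ₁-even σ₂-even j = evenBelow-cong (𝕊.sym (satisfies-recurrence quotient quotient-recurrence j))
      (evenBelow-recurrence σ₁-even σ₂-even (λ _ _ → evenPoly-0)
        (evenBelow-cong (𝕊.sym (𝕊.trans (𝕊.+-congˡ {𝕊.1#} (𝕊.zeroʳ W̃)) (𝕊.+-identityʳ 𝕊.1#))) evenBelow-1) j)

    powerSum-evenBelow : ∀ {s} → EvenBelow σ₁ s → EvenBelow σ₂ s → ∀ j → EvenBelow (powerSum j) s
    powerSum-evenBelow σ₁-even σ₂-even j = evenBelow-cong (𝕊.sym (satisfies-recurrence powerSum powerSum-recurrence j))
      (evenBelow-recurrence σ₁-even σ₂-even (evenBelow-+ evenBelow-1 evenBelow-1)
        (evenBelow-cong (𝕊.sym (𝕊.+-cong (𝕊.*-identityʳ V) (𝕊.*-identityʳ W̃))) σ₁-even) j)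

    quotient₂≈σ₁ : quotient 2 𝕊.≈ σ₁
    quotient₂≈σ₁ = 𝕊.trans (satisfies-recurrence quotient quotient-recurrence 2)
      (𝕊.trans (𝕊.+-cong (𝕊.trans (𝕊.*-congˡ {σ₁} (𝕊.+-congˡ {𝕊.1#} (𝕊.zeroʳ W̃)))
                                   (𝕊.trans (𝕊.*-congˡ {σ₁} (𝕊.+-identityʳ 𝕊.1#)) (𝕊.*-identityʳ σ₁)))
                         (𝕊.-‿cong (𝕊.zeroʳ σ₂)))
         (𝕊.trans (𝕊.+-congˡ {σ₁} (Algebra.Properties.Ring.-0#≈0# 𝕊.ring)) (𝕊.+-identityʳ σ₁)))
      where import Algebra.Properties.Ring

    powerSum₂≈ : powerSum 2 𝕊.≈ ((σ₁ 𝕊.* σ₁) 𝕊.- (σ₂ 𝕊.+ σ₂))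
    powerSum₂≈ = 𝕊.trans (𝕊.+-cong (𝕊.*-congˡ {V} (𝕊.*-identityʳ V)) (𝕊.*-congˡ {W̃} (𝕊.*-identityʳ W̃)))
      (solve𝕊 2 (λ v w → (v :*𝕊 v) :+𝕊 (w :*𝕊 w) :=𝕊 ((v :+𝕊 w) :*𝕊 (v :+𝕊 w)) :-𝕊 ((v :*𝕊 w) :+𝕊 (v :*𝕊 w)))
        𝕊.refl V W̃)

    σ₁-equation : σ₁ 𝕊.≈ ((tSlice 𝕊.+ tSlice) 𝕊.+ Φ Λ powerSum)
    σ₁-equation = 𝕊.trans (𝕊.+-cong V-eq W̃-slice-equation)
      (𝕊.trans (solve𝕊 3 (λ x a b → (x :+𝕊 a) :+𝕊 (x :+𝕊 b) :=𝕊 (x :+𝕊 x) :+𝕊 (a :+𝕊 b))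
                          𝕊.refl tSlice (Φ Λ (V ^_)) (Φ Λ (W̃ ^_)))
        (𝕊.+-congˡ {tSlice 𝕊.+ tSlice} (𝕊.sym (Φ-+ (V ^_) (W̃ ^_)))))

    -- Slice s of Φ(quotient) = 1 reads  λ₂ σ₁,ₛ + (terms below s) = δₛ₀.
    σ₁-slice-evenPoly : ∀ s → EvenBelow σ₁ s → EvenBelow σ₂ s → EvenPoly (σ₁ s)
    σ₁-slice-evenPoly s σ₁-even σ₂-even = evenPoly-cong (Ps.sym σ₁ₛ≈)
      (evenPoly-· λ₂⁻¹ (evenPoly-sub (evenBelow-1 s ℕP.≤-refl)
        (Φ-tail-evenPoly quotient s (quotient-evenBelow σ₁-even σ₂-even))))
      where
      λ₂⁻¹ = inverse λ₂ λ₂≉0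
      λ₂σ₁ₛ+tail≈1 : ((l *ₛ σ₁ s) +ₛ Φ-tail quotient s) ≈ₛ 𝕊.1# s
      λ₂σ₁ₛ+tail≈1 = Ps.trans (Ps.+-congʳ {Φ-tail quotient s} (Ps.sym (·ₛ≈constₛ-*ₛ λ₂ (σ₁ s))))
        (Ps.trans (λ n → +-congʳ (*-congˡ (sym (quotient₂≈σ₁ s n))))
          (Ps.trans (λ n → sym (Φ-split quotient s n)) (Φquotient≈1 s)))
      σ₁ₛ≈ : σ₁ s ≈ₛ (λ₂⁻¹ ·ₛ (𝕊.1# s Ps.- Φ-tail quotient s))
      σ₁ₛ≈ = Ps.sym (begin
        λ₂⁻¹ ·ₛ (𝕊.1# s Ps.- Φ-tail quotient s)
          ≈⟨ ·ₛ≈constₛ-*ₛ λ₂⁻¹ _ ⟩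
        constₛ λ₂⁻¹ *ₛ (𝕊.1# s Ps.- Φ-tail quotient s)
          ≈⟨ Ps.*-congˡ {constₛ λ₂⁻¹} (Ps.+-congʳ {Ps.- Φ-tail quotient s} (Ps.sym λ₂σ₁ₛ+tail≈1)) ⟩
        constₛ λ₂⁻¹ *ₛ (((l *ₛ σ₁ s) +ₛ Φ-tail quotient s) Ps.- Φ-tail quotient s)
          ≈⟨ solveₛ 4 (λ i l x r → i :*ₛ (((l :*ₛ x) :+ₛ r) :-ₛ r) :=ₛ (i :*ₛ l) :*ₛ x)
               Ps.refl (constₛ λ₂⁻¹) l (σ₁ s) (Φ-tail quotient s) ⟩
        (constₛ λ₂⁻¹ *ₛ l) *ₛ σ₁ s
          ≈⟨ Ps.*-congʳ {σ₁ s} (Ps.trans (Ps.sym (constₛ-* λ₂⁻¹ λ₂))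
               (Ps.trans (constₛ-cong (trans (*-comm λ₂⁻¹ λ₂) (*-inverseʳ λ₂ λ₂≉0))) constₛ-1)) ⟩
        oneₛ *ₛ σ₁ s
          ≈⟨ Ps.*-identityˡ (σ₁ s) ⟩
        σ₁ s ∎)

    -- Slice s of σ₁ = 2t + Φ(powerSum) involves σ₂,ₛ only through λ₂ (σ₁² − 2σ₂)ₛ.
    σ₂-slice-evenPoly : ∀ s → EvenBelow σ₁ (suc s) → EvenBelow σ₂ s → EvenPoly (σ₂ s)
    σ₂-slice-evenPoly s σ₁-even σ₂-even = evenPoly-cong (Ps.sym σ₂ₛ≈)
      (evenPoly-· e₀ (evenPoly-sub (evenPoly-+ (evenPoly-+ (tSlice-evenPoly s) (tSlice-evenPoly s))
        (evenPoly-+ (evenPoly-· λ₂ (evenBelow-* σ₁-even σ₁-even s ℕP.≤-refl))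
          (Φ-tail-evenPoly powerSum s (powerSum-evenBelow (λ p p<s → σ₁-even p (ℕP.m≤n⇒m≤1+n p<s)) σ₂-even))))
        (σ₁-even s ℕP.≤-refl)))
      where
      x = tSlice s
      y = (σ₁ 𝕊.* σ₁) s
      r = Φ-tail powerSum s
      σ₁ₛ≈ : σ₁ s ≈ₛ ((x +ₛ x) +ₛ ((l *ₛ (y Ps.- (σ₂ s +ₛ σ₂ s))) +ₛ r))
      σ₁ₛ≈ = Ps.trans (σ₁-equation s) (Ps.+-congˡ {x +ₛ x} (Ps.trans (λ n → Φ-split powerSum s n)
        (Ps.+-congʳ {r} (Ps.trans (λ n → *-congˡ (powerSum₂≈ s n)) (·ₛ≈constₛ-*ₛ λ₂ (y Ps.- (σ₂ s +ₛ σ₂ s)))))))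
      σ₂ₛ≈ : σ₂ s ≈ₛ (e₀ ·ₛ (((x +ₛ x) +ₛ ((λ₂ ·ₛ y) +ₛ r)) Ps.- σ₁ s))
      σ₂ₛ≈ = Ps.sym (begin
        e₀ ·ₛ (((x +ₛ x) +ₛ ((λ₂ ·ₛ y) +ₛ r)) Ps.- σ₁ s)
          ≈⟨ ·ₛ≈constₛ-*ₛ e₀ _ ⟩
        e *ₛ (((x +ₛ x) +ₛ ((λ₂ ·ₛ y) +ₛ r)) Ps.- σ₁ s)
          ≈⟨ Ps.*-congˡ {e} (Ps.+-cong (Ps.+-congˡ {x +ₛ x} (Ps.+-congʳ {r} (·ₛ≈constₛ-*ₛ λ₂ y))) (Ps.-‿cong σ₁ₛ≈)) ⟩
        e *ₛ (((x +ₛ x) +ₛ ((l *ₛ y) +ₛ r)) Ps.- ((x +ₛ x) +ₛ ((l *ₛ (y Ps.- (σ₂ s +ₛ σ₂ s))) +ₛ r)))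
          ≈⟨ solveₛ 6 (λ e x y z r l → e :*ₛ (((x :+ₛ x) :+ₛ ((l :*ₛ y) :+ₛ r))
                                            :-ₛ ((x :+ₛ x) :+ₛ ((l :*ₛ (y :-ₛ (z :+ₛ z))) :+ₛ r)))
               :=ₛ ((conₛ (1 , 0) :+ₛ conₛ (1 , 0)) :*ₛ (l :*ₛ e)) :*ₛ z) Ps.refl e x y (σ₂ s) r l ⟩
        ((O +ₛ O) *ₛ (l *ₛ e)) *ₛ σ₂ s
          ≈⟨ Ps.*-congʳ {σ₂ s} (Ps.trans [1+1]le≈1 O≈1) ⟩
        oneₛ *ₛ σ₂ s
          ≈⟨ Ps.*-identityˡ (σ₂ s) ⟩
        σ₂ s ∎)

    symmetric-evenPoly : ∀ s → EvenPoly (σ₁ s) × EvenPoly (σ₂ s)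
    symmetric-evenPoly = <-rec _ step
      where
      step : ∀ s → (∀ {p} → p < s → EvenPoly (σ₁ p) × EvenPoly (σ₂ p)) → EvenPoly (σ₁ s) × EvenPoly (σ₂ s)
      step s below = σ₁ₛ-even , σ₂-slice-evenPoly s σ₁-upto-s σ₂-below
        where
        σ₁-below : EvenBelow σ₁ s
        σ₁-below p p<s = proj₁ (below p<s)
        σ₂-below : EvenBelow σ₂ s
        σ₂-below p p<s = proj₂ (below p<s)
        σ₁ₛ-even : EvenPoly (σ₁ s)
        σ₁ₛ-even = σ₁-slice-evenPoly s σ₁-below σ₂-below
        σ₁-upto-s : EvenBelow σ₁ (suc s)
        σ₁-upto-s p (s≤s p≤s) with ℕP.m≤n⇒m<n∨m≡n p≤s
        ... | inj₁ p<s    = σ₁-below p p<s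
        ... | inj₂ ≡.refl = σ₁ₛ-even

    Δ : Slices
    Δ = (σ₁ 𝕊.* σ₁) 𝕊.- (((σ₂ 𝕊.+ σ₂) 𝕊.+ σ₂) 𝕊.+ σ₂)

    D²≈Δ : (D 𝕊.* D) 𝕊.≈ Δ
    D²≈Δ = solve𝕊 2 (λ v w → (v :-𝕊 w) :*𝕊 (v :-𝕊 w)
        :=𝕊 ((v :+𝕊 w) :*𝕊 (v :+𝕊 w)) :-𝕊 ((((v :*𝕊 w) :+𝕊 (v :*𝕊 w)) :+𝕊 (v :*𝕊 w)) :+𝕊 (v :*𝕊 w)))
      𝕊.refl V W̃

    Δ-evenPoly : ∀ s → EvenPoly (Δ s)
    Δ-evenPoly s = evenBelow-sub (evenBelow-* σ₁-even σ₁-even)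
      (evenBelow-+ (evenBelow-+ (evenBelow-+ σ₂-even σ₂-even) σ₂-even) σ₂-even) s ℕP.≤-refl
      where
      σ₁-even : EvenBelow σ₁ (suc s)
      σ₁-even p _ = proj₁ (symmetric-evenPoly p)
      σ₂-even : EvenBelow σ₂ (suc s)
      σ₂-even p _ = proj₂ (symmetric-evenPoly p)

    interior-evenLaurent : ∀ p → (∀ {r} → r < suc p → OddLaurent (D r)) → EvenLaurent (interior D (suc p))
    interior-evenLaurent zero    _   = evenPoly⇒evenLaurent evenPoly-0
    interior-evenLaurent (suc p) odd = evenLaurent-sumTo p _ (λ r r≤p →
      oddLaurent-* (odd (s≤s (s≤s r≤p))) (odd (s≤s (ℕP.m∸n≤m (suc p) r))))

    i2 : Carrier
    i2 = inverse two two≉0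

    -- Slice s+1 of D² = Δ is linear in D_{s+1}, with coefficient 2D₀ = −2S/λ₂.
    D-slice-suc : ∀ p → D (suc p) ≈ₛ ((i2 * - λ₂) ·ₛ (Sinv *ₛ (Δ (suc p) Ps.- interior D (suc p))))
    D-slice-suc p = Ps.sym (begin
      (i2 * - λ₂) ·ₛ (Sinv *ₛ z)
        ≈⟨ ·ₛ≈constₛ-*ₛ (i2 * - λ₂) (Sinv *ₛ z) ⟩
      constₛ (i2 * - λ₂) *ₛ (Sinv *ₛ z)
        ≈⟨ Ps.*-congʳ {Sinv *ₛ z} (Ps.trans (constₛ-* i2 (- λ₂)) (Ps.*-congˡ {constₛ i2} (constₛ-neg λ₂))) ⟩
      (constₛ i2 *ₛ (Ps.- l)) *ₛ (Sinv *ₛ z)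
        ≈⟨ solveₛ 4 (λ u m s z → (u :*ₛ m) :*ₛ (s :*ₛ z) :=ₛ (u :*ₛ (m :*ₛ s)) :*ₛ z) Ps.refl (constₛ i2) (Ps.- l) Sinv z ⟩
      (constₛ i2 *ₛ D₀⁻¹) *ₛ z
        ≈⟨ Ps.*-congˡ {constₛ i2 *ₛ D₀⁻¹} (Ps.sym 2D₀Dₚ≈z) ⟩
      (constₛ i2 *ₛ D₀⁻¹) *ₛ ((D 0 *ₛ Dₚ) +ₛ (Dₚ *ₛ D 0))
        ≈⟨ solveₛ 4 (λ u k d x → (u :*ₛ k) :*ₛ ((d :*ₛ x) :+ₛ (x :*ₛ d))
                                   :=ₛ (((conₛ (1 , 0) :+ₛ conₛ (1 , 0)) :*ₛ u) :*ₛ (d :*ₛ k)) :*ₛ x)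
             Ps.refl (constₛ i2) D₀⁻¹ (D 0) Dₚ ⟩
      (((O +ₛ O) *ₛ constₛ i2) *ₛ (D 0 *ₛ D₀⁻¹)) *ₛ Dₚ
        ≈⟨ Ps.*-congʳ {Dₚ} (Ps.*-cong 2i2≈1 D₀*D₀⁻¹≈1) ⟩
      (O *ₛ O) *ₛ Dₚ
        ≈⟨ solveₛ 1 (λ x → (conₛ (1 , 0) :*ₛ conₛ (1 , 0)) :*ₛ x :=ₛ x) Ps.refl Dₚ ⟩
      Dₚ ∎)
      where
      Dₚ = D (suc p)
      z = Δ (suc p) Ps.- interior D (suc p)
      2D₀Dₚ≈z : ((D 0 *ₛ Dₚ) +ₛ (Dₚ *ₛ D 0)) ≈ₛ z
      2D₀Dₚ≈z = Ps.trans (Ps.sym (Ps.+-identityʳ _))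
        (Ps.trans (Ps.+-congˡ {(D 0 *ₛ Dₚ) +ₛ (Dₚ *ₛ D 0)} (Ps.sym (Ps.-‿inverseʳ (interior D (suc p)))))
        (Ps.trans (Ps.sym (Ps.+-assoc _ (interior D (suc p)) (Ps.- interior D (suc p))))
          (Ps.+-congʳ {Ps.- interior D (suc p)} (Ps.trans (Ps.sym (square-slice D p)) (D²≈Δ (suc p))))))
      2i2≈1 : ((O +ₛ O) *ₛ constₛ i2) ≈ₛ O
      2i2≈1 = Ps.trans
        (Ps.*-congʳ {constₛ i2} (Ps.trans (Ps.+-cong O≈1 O≈1) (Ps.sym (Ps.trans (constₛ-+ 1# 1#) (Ps.+-cong constₛ-1 constₛ-1)))))
        (Ps.trans (Ps.sym (constₛ-* two i2)) (Ps.trans (constₛ-cong (*-inverseʳ two two≉0)) (Ps.trans constₛ-1 (Ps.sym O≈1))))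

    D-oddLaurent : ∀ s → OddLaurent (D s)
    D-oddLaurent = <-rec _ step
      where
      step : ∀ s → (∀ {r} → r < s → OddLaurent (D r)) → OddLaurent (D s)
      step zero    _   = oddLaurent-cong (Ps.sym (Ps.trans D₀≈ D₀≈b·S)) (oddLaurent-S (- (e₀ + e₀)))
        where
        D₀≈b·S : (Ps.- ((S +ₛ S) *ₛ e)) ≈ₛ ((- (e₀ + e₀)) ·ₛ S)
        D₀≈b·S = Ps.sym (Ps.trans (·ₛ≈constₛ-*ₛ _ S)
          (Ps.trans (Ps.*-congʳ {S} (Ps.trans (constₛ-neg (e₀ + e₀)) (Ps.-‿cong (constₛ-+ e₀ e₀))))
          (solveₛ 2 (λ e s → (:-ₛ (e :+ₛ e)) :*ₛ s :=ₛ :-ₛ ((s :+ₛ s) :*ₛ e)) Ps.refl e S)))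
      step (suc p) odd = oddLaurent-cong (Ps.sym (D-slice-suc p)) (oddLaurent-· (i2 * - λ₂) (Sinv*evenLaurent
        (evenLaurent-sub (evenPoly⇒evenLaurent (Δ-evenPoly (suc p))) (interior-evenLaurent p odd))))

    V-noEvenNeg : ∀ s → NoEvenNeg (V s)
    V-noEvenNeg s = noEvenNeg-cong halves (noEvenNeg-· i2 (noEvenNeg-+ (evenPoly⇒noEvenNeg (proj₁ (symmetric-evenPoly s)))
      (oddLaurent⇒noEvenNeg (D-oddLaurent s))))
      where
      halves : (i2 ·ₛ (σ₁ s +ₛ D s)) ≈ₛ V s
      halves n = trans (solveK 3 (λ i v w → i :*K ((v :+K w) :+K (v :-K w)) :=K ((conK (1 , 0) :+K conK (1 , 0)) :*K i) :*K v)
                         refl i2 (V s n) (W̃ s n))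
        (trans (*-congʳ (trans (*-congʳ (+-cong ⟦1⟧ℤ≈1# ⟦1⟧ℤ≈1#)) (*-inverseʳ two two≉0))) (*-identityˡ _))

theorem6 : ∀ {c ℓ} (K : CommutativeRing c ℓ) →
    let open CommutativeRing K
        open PowerSeries K
    in IsField → CharZero →
       (Λ : Series) → Λ 0 ≈ 0# → Λ 1 ≈ 0# → ¬ (Λ 2 ≈ 0#) →
       Σ Series₂ λ H →
         IsSolution Λ H
         × (∀ H′ → IsSolution Λ H′ → H′ ≈₂ H)
         × (∀ m → H 0 m ≈ 0#)
         × (∀ n m → n ≤ m → H (suc n) (suc m) ≈ 0#)
         × (∀ n → ¬ (H (suc n) n ≈ 0#))
         × (∀ (l : ℕ) → (S Sinv : Series) →
              S 0 ≈ 1# →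
              (S *ₛ S) ≈ₛ (oneₛ -ₛ (((4 ·ℕ 1#) * Λ 2) ·ₛ tₛ)) →
              (S *ₛ Sinv) ≈ₛ oneₛ →
              LaurentNoEvenNeg S Sinv (diagonal H l))
theorem6 K isField char0 Λ Λ₀≈0 Λ₁≈0 λ₂≉0 =
  H , H-solution , H-unique , row-zero , above-diagonal , subdiagonal-nonzero , diagonals-laurent
  where
  open CommutativeRing K
  open PowerSeries K
  open Solution K Λ
  open SolutionSupport K Λ Λ₀≈0 Λ₁≈0
  open DiagonalProduct K
  open DiagonalsOfSolution K Λ Λ₀≈0 Λ₁≈0

  row-zero : ∀ m → H 0 m ≈ 0#
  row-zero m = H-support 0 m (ℕP.m≤n+m 1 m)

  above-diagonal : ∀ n m → n ≤ m → H (suc n) (suc m) ≈ 0#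
  above-diagonal n m n≤m = H-support (suc n) (suc m) (s≤s (ℕP.≤-trans (s≤s n≤m) (ℕP.≤-reflexive (ℕP.+-comm 1 m))))

  subdiagonal-nonzero : ∀ n → ¬ (H (suc n) n ≈ 0#)
  subdiagonal-nonzero n H≈0 = CatalanCoefficients.h-nonzero K (Λ 2) (W 0) W₀₀≈0 W₀-catalan isField char0 λ₂≉0 n
    (trans (diagonal-≤ H 1 (suc n) (s≤s z≤n)) H≈0)

  diagonals-laurent : ∀ l S Sinv → S 0 ≈ 1# → (S *ₛ S) ≈ₛ (oneₛ -ₛ (((4 ·ℕ 1#) * Λ 2) ·ₛ tₛ)) →
    (S *ₛ Sinv) ≈ₛ oneₛ → LaurentNoEvenNeg S Sinv (diagonal H l)
  diagonals-laurent zero    S Sinv _ _ S*Sinv≈1 =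
    ParityClasses.noEvenNeg-cong K S Sinv S*Sinv≈1 (λ n → sym (diagonal-zero n)) (ParityClasses.noEvenNeg-poly K S Sinv S*Sinv≈1 [])
  diagonals-laurent (suc q) S Sinv S₀≈1 S²≈ S*Sinv≈1 =
    LaurentStructure.V-noEvenNeg K isField char0 Λ λ₂≉0 S Sinv S₀≈1 S²≈ S*Sinv≈1 W W-slice-equation W₀₀≈0 q
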